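{- Let $f = f(x_1,\ldots,x_n)$ be a positive threshold split Boolean function with $k\ge 0$ relevant variables. Then the number of extremal points of $f$ is at least $k+1$. Moreover, $f$ has exactly $k+1$ extremal points if and only if $f$ is linear read-once.
   Context: $B=\{0,1\}$; for $x,y\in B^n$, $x\preceq y$ means $(x)_i=1$ implies $(y)_i=1$. $f$ is positive if $f(x)=1$ and $x\preceq y$ imply $f(y)=1$; threshold if there are reals $w_1,\dots,w_n,t$ with $f(x)=0\iff\sum_i w_ix_i\le t$. For $i\in[n]$ and $\alpha\in B$, $f_{|x_i=\alpha}$ is the function of the remaining $n-1$ variables obtained by fixing $x_i=\alpha$. $x_i$ is relevant if $f_{|x_i=0}\not\equiv f_{|x_i=1}$. $f$ is split if there is $i\in[n]$ with $f_{|x_i=0}\equiv 0$ or $f_{|x_i=1}\equiv 1$. Extremal points of a positive $f$ are its $\preceq$-maximal false points and $\preceq$-minimal true points. A Boolean function is linear read-once if it is constant or representable by a nested formula: the literals $x$, $\bar x$ are nested formulas; if $t$ is a nested formula containing neither $x$ nor $\bar x$ then $x\vee t$, $x\wedge t$, $\bar x\vee t$, $\bar x\wedge t$ are nested formulas.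
   Formalization: The weights $w_1,\dots,w_n$ and the threshold $t$ of a threshold function are rational rather than real. -}

module Defs where

open import Data.Bool using (Bool; true; false; not; _∧_; _∨_; if_then_else_)
open import Data.Nat using (ℕ; zero; suc; pred)
open import Data.Fin using (Fin)
open import Data.Vec using (Vec; []; _∷_; lookup; insertAt; zipWith; foldr)
open import Data.List using (List; []; _∷_; _++_; map; length)
open import Data.Bool.ListAction using (any; all)
open import Data.List.Membership.Propositional using (_∉_)
open import Data.Fin.Base using () renaming (zero to fzero; suc to fsuc)
import Data.List as L
open import Data.Product using (Σ; ∃; _×_; _,_)
open import Data.Sum using (_⊎_)
open import Relation.Binary.PropositionalEquality using (_≡_)
open import Relation.Nullary using (¬_)
open import Data.Rational using (ℚ; _+_; _*_; _≤_; 0ℚ; 1ℚ)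
open import Function.Bundles using (_⇔_)

-- B = Bool (false = 0, true = 1); a Boolean function of n variables
BoolFn : ℕ → Set
BoolFn n = Vec Bool n → Bool

allVecs : (n : ℕ) → List (Vec Bool n)
allVecs zero    = [] ∷ []
allVecs (suc n) = map (false ∷_) (allVecs n) ++ map (true ∷_) (allVecs n)

count : ∀ {A : Set} → (A → Bool) → List A → ℕ
count p xs = length (L.filterᵇ p xs)

_⪯_ : ∀ {n} → Vec Bool n → Vec Bool n → Set
x ⪯ y = ∀ i → lookup x i ≡ true → lookup y i ≡ true

_⪯ᵇ_ : ∀ {n} → Vec Bool n → Vec Bool n → Bool
[] ⪯ᵇ [] = true
(a ∷ x) ⪯ᵇ (b ∷ y) = (not a ∨ b) ∧ (x ⪯ᵇ y)

_=ᵇ_ : ∀ {n} → Vec Bool n → Vec Bool n → Bool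
[] =ᵇ [] = true
(a ∷ x) =ᵇ (b ∷ y) = (if a then b else not b) ∧ (x =ᵇ y)

Positive : ∀ {n} → BoolFn n → Set
Positive {n} f = ∀ (x y : Vec Bool n) → f x ≡ true → x ⪯ y → f y ≡ true

toℚ : Bool → ℚ
toℚ true  = 1ℚ
toℚ false = 0ℚ

wsum : ∀ {n} → Vec ℚ n → Vec Bool n → ℚ
wsum w x = foldr _ _+_ 0ℚ (zipWith (λ wi xi → wi * toℚ xi) w x)

Threshold : ∀ {n} → BoolFn n → Set
Threshold {n} f = Σ (Vec ℚ n) λ w → Σ ℚ λ t →
  ∀ (x : Vec Bool n) → (f x ≡ false) ⇔ (wsum w x ≤ t)

restrict : ∀ {n} → BoolFn n → Fin n → Bool → BoolFn (pred n)
restrict {suc m} f i α z = f (insertAt z i α)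

Relevant : ∀ {n} → BoolFn n → Fin n → Set
Relevant {n} f i = ¬ (∀ z → restrict f i false z ≡ restrict f i true z)

relevantᵇ : ∀ {n} → BoolFn n → Fin n → Bool
relevantᵇ {n} f i =
  any (λ z → not (restrict f i false z =ᵇ' restrict f i true z)) (allVecs (pred n))
  where
  _=ᵇ'_ : Bool → Bool → Bool
  a =ᵇ' b = if a then b else not b

numRelevant : ∀ {n} → BoolFn n → ℕ
numRelevant {n} f = count (relevantᵇ f) (Data.List.allFin n)
  where open import Data.List using (allFin)

Split : ∀ {n} → BoolFn n → Set
Split {n} f = ∃ λ (i : Fin n) →
  (∀ z → restrict f i false z ≡ false) ⊎ (∀ z → restrict f i true z ≡ true)

maxFalseᵇ : ∀ {n} → BoolFn n → Vec Bool n → Bool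
maxFalseᵇ {n} f x =
  not (f x) ∧ all (λ y → not (x ⪯ᵇ y ∧ not (f y)) ∨ (y =ᵇ x)) (allVecs n)

minTrueᵇ : ∀ {n} → BoolFn n → Vec Bool n → Bool
minTrueᵇ {n} f x =
  f x ∧ all (λ y → not (y ⪯ᵇ x ∧ f y) ∨ (y =ᵇ x)) (allVecs n)

numExtremal : ∀ {n} → BoolFn n → ℕ
numExtremal {n} f = count (λ x → maxFalseᵇ f x ∨ minTrueᵇ f x) (allVecs n)

-- Boolean formulas over literals x_i (pol = true) / x̄_i (pol = false)
data Formula (n : ℕ) : Set where
  lit  : Fin n → Bool → Formula n
  _∨F_ : Formula n → Formula n → Formula n
  _∧F_ : Formula n → Formula n → Formula n

eval : ∀ {n} → Formula n → Vec Bool n → Bool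
eval (lit i true)  x = lookup x i
eval (lit i false) x = not (lookup x i)
eval (φ ∨F ψ) x = eval φ x ∨ eval ψ x
eval (φ ∧F ψ) x = eval φ x ∧ eval ψ x

vars : ∀ {n} → Formula n → List (Fin n)
vars (lit i _) = i ∷ []
vars (φ ∨F ψ) = vars φ ++ vars ψ
vars (φ ∧F ψ) = vars φ ++ vars ψ

data Nested {n : ℕ} : Formula n → Set where
  nlit : ∀ i b → Nested (lit i b)
  nor  : ∀ i b {t} → i ∉ vars t → Nested t → Nested (lit i b ∨F t)
  nand : ∀ i b {t} → i ∉ vars t → Nested t → Nested (lit i b ∧F t)

LinearReadOnce : ∀ {n} → BoolFn n → Set
LinearReadOnce {n} f =
  (∃ λ (c : Bool) → ∀ x → f x ≡ c)
  ⊎ (∃ λ (φ : Formula n) → Nested φ × (∀ x → f x ≡ eval φ x))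

-- Write E f and K f for the numbers of extremal points and of relevant variables of a positive f.
-- Fixing a relevant variable x_v to 1 gives f₁ with E f₁ < E f: grouping the cube into the edges
-- {x, x [ v ]≔ true} with x_v = 0, each edge carries at least as many extremal points of f as of f₁,
-- and the edge at a maximal false point with x_v = 0 carries strictly more. Some relevant x_v can be
-- fixed to 1, in f or in its dual, without making another variable irrelevant (take one whose fixing
-- kills the fewest), so then K f ≤ K f₁ + 1 and induction on K gives E ≥ K + 1, and even E ≥ K + 2
-- unless f is split. Hence E = K + 1 forces f = x_u ∧ g or f = x_u ∨ g with g again tight, so f is
-- linear read-once; conversely E (x_u ∧ g) ≤ E g + 1, which gives E = K + 1 for nested formulas.

module Submission where

open import Defs
open import Data.Nat using (ℕ; suc; _≤_)
open import Data.Product using (_×_)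
open import Relation.Binary.PropositionalEquality using (_≡_)
open import Function.Bundles using (_⇔_)

open import Data.Bool using (Bool; true; false; not; _∧_; _∨_; if_then_else_)
open import Data.Bool.ListAction using (all; any)
open import Data.Bool.Properties
  using (not-involutive; not-injective; T-≡; ∧-zeroʳ; ∧-identityʳ; ∨-identityʳ) renaming (_≟_ to _≟ᴮ_)
open import Data.Empty using (⊥; ⊥-elim)
open import Data.Fin using (Fin) renaming (zero to fzero; suc to fsuc)
open import Data.Fin.Properties using (_≟_; any?)
open import Data.List as List using (List; []; _∷_; _++_; allFin)
open import Data.List.Membership.Propositional using (_∈_; _∉_; lose)
open import Data.List.Membership.Propositional.Properties
  using (∈-allFin; ∈-++⁺ˡ; ∈-++⁺ʳ; ∈-map⁺; ∈-map⁻)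
open import Data.List.Properties using (map-++; map-∘; map-cong)
open import Data.List.Relation.Binary.Disjoint.Propositional using (Disjoint)
open import Data.List.Relation.Unary.All as All using (All)
open import Data.List.Relation.Unary.All.Properties using (all⁺; all⁻)
open import Data.List.Relation.Unary.AllPairs using ([]; _∷_)
open import Data.List.Relation.Unary.Any using (here; there; satisfied)
open import Data.List.Relation.Unary.Any.Properties using (any⁺; any⁻)
open import Data.List.Relation.Unary.Unique.Propositional using (Unique)
import Data.List.Relation.Unary.Unique.Propositional.Properties as Unique
open import Data.Nat using (zero; _+_; _<_; z≤n; s≤s)
open import Data.Nat.Induction using (<-wellFounded)
open import Data.Nat.ListAction using (sum)
open import Data.Nat.ListAction.Properties using (sum-++)
open import Data.Nat.Properties
  using (module ≤-Reasoning; ≤-refl; ≤-trans; ≤-antisym; ≤-pred; n≮n; m≤m+n; m≤n+m;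
         +-mono-≤; +-mono-<-≤; +-mono-≤-<; +-suc; +-comm; +-identityʳ; +-commutativeSemigroup)
open import Algebra.Properties.CommutativeSemigroup +-commutativeSemigroup using (interchange)
open import Data.Product using (∃; _,_; proj₁; proj₂)
open import Data.Sum as Sum using (_⊎_; inj₁; inj₂)
open import Data.Vec as Vec using (Vec; []; _∷_; lookup; replicate; _[_]≔_; insertAt; removeAt)
open import Data.Vec.Properties
  using (lookup∘update; lookup∘update′; []≔-lookup; []≔-idempotent; []≔-commutes; map-[]≔;
         lookup-replicate; lookup-map; tabulate∘lookup; tabulate-cong; ∷-injective; ≡-dec; insertAt-removeAt)
open import Function using (_∘_; const)
open import Function.Bundles using (mk⇔; module Equivalence)
open import Induction.WellFounded using (Acc; acc)
open import Level using (0ℓ)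
open import Relation.Binary using (DecidableEquality)
open import Relation.Binary.PropositionalEquality
  using (_≢_; _≗_; refl; sym; trans; cong; cong₂; subst; subst₂; module ≡-Reasoning)
open import Relation.Nullary using (¬_; Dec; yes; no; does; _because_; contradiction)
open import Relation.Nullary.Decidable using (map′; _⊎-dec_; _×-dec_; ¬?; dec-true; dec-false)
open import Relation.Nullary.Reflects using (Reflects; ofʸ; ofⁿ)
open import Relation.Unary using (Pred; Decidable)

open Equivalence using (to; from)

private
  variable
    n : ℕ
    A : Set

true≢false : true ≢ false
true≢false ()

bit : Bool → ℕ
bit false = 0
bit true  = 1

bit≤1 : ∀ b → bit b ≤ 1
bit≤1 false = z≤n
bit≤1 true  = ≤-refl

-- The cube B^n

zeros ones : Vec Bool n
zeros = replicate _ false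
ones  = replicate _ true

complement : Vec Bool n → Vec Bool n
complement = Vec.map not

complement-involutive : (x : Vec Bool n) → complement (complement x) ≡ x
complement-involutive []      = refl
complement-involutive (b ∷ x) = cong₂ _∷_ (not-involutive b) (complement-involutive x)

lookup-injective : {x y : Vec Bool n} → (∀ i → lookup x i ≡ lookup y i) → x ≡ y
lookup-injective {x = x} {y} eq = begin
  x                        ≡⟨ tabulate∘lookup x ⟨
  Vec.tabulate (lookup x)  ≡⟨ tabulate-cong eq ⟩
  Vec.tabulate (lookup y)  ≡⟨ tabulate∘lookup y ⟩
  y                        ∎
  where open ≡-Reasoning

[]≔-id : (x : Vec Bool n) (i : Fin n) {b : Bool} → lookup x i ≡ b → x [ i ]≔ b ≡ x
[]≔-id x i refl = []≔-lookup x i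

⪯-trans : (x y z : Vec Bool n) → x ⪯ y → y ⪯ z → x ⪯ z
⪯-trans _ _ _ x⪯y y⪯z i xᵢ = y⪯z i (x⪯y i xᵢ)

⪯-antisym : {x y : Vec Bool n} → x ⪯ y → y ⪯ x → x ≡ y
⪯-antisym {x = x} {y} x⪯y y⪯x = lookup-injective same
  where
  same : ∀ i → lookup x i ≡ lookup y i
  same i with lookup x i in xᵢ
  ... | true = sym (x⪯y i xᵢ)
  ... | false with lookup y i in yᵢ
  ...   | true  = trans (sym xᵢ) (y⪯x i yᵢ)
  ...   | false = refl

⪯-[]≔true : (x : Vec Bool n) (i : Fin n) → x ⪯ (x [ i ]≔ true)
⪯-[]≔true x i j xⱼ with j ≟ i
... | yes refl = lookup∘update i x true
... | no  j≢i  = trans (lookup∘update′ j≢i x true) xⱼ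

[]≔false-⪯ : (x : Vec Bool n) (i : Fin n) → (x [ i ]≔ false) ⪯ x
[]≔false-⪯ x i j h with j ≟ i
... | yes refl = contradiction (trans (sym h) (lookup∘update i x false)) true≢false
... | no  j≢i  = trans (sym (lookup∘update′ j≢i x false)) h

[]≔-mono : (x y : Vec Bool n) → x ⪯ y → ∀ i b → (x [ i ]≔ b) ⪯ (y [ i ]≔ b)
[]≔-mono x y x⪯y i b j h with j ≟ i
... | yes refl = trans (lookup∘update i y b) (trans (sym (lookup∘update i x b)) h)
... | no  j≢i  = trans (lookup∘update′ j≢i y b) (x⪯y j (trans (sym (lookup∘update′ j≢i x b)) h))

zeros-⪯ : (x : Vec Bool n) → zeros ⪯ x
zeros-⪯ x i h = contradiction (trans (sym h) (lookup-replicate i false)) true≢false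

⪯-ones : (x : Vec Bool n) → x ⪯ ones
⪯-ones x i _ = lookup-replicate i true

complement-antitone : (x y : Vec Bool n) → x ⪯ y → complement y ⪯ complement x
complement-antitone x y x⪯y i h with lookup x i in xᵢ
... | false = trans (lookup-map i not x) (cong not xᵢ)
... | true  = contradiction (trans (sym h) (trans (lookup-map i not y) (cong not (x⪯y i xᵢ)))) true≢false

[]≔false-⪯-[]≔true : (x : Vec Bool n) (i : Fin n) → (x [ i ]≔ false) ⪯ (x [ i ]≔ true)
[]≔false-⪯-[]≔true x i = ⪯-trans (x [ i ]≔ false) x (x [ i ]≔ true) ([]≔false-⪯ x i) (⪯-[]≔true x i)

⪯-[]≔-cancel : (y x : Vec Bool n) (i : Fin n) (b : Bool) → y ⪯ (x [ i ]≔ b) → (y [ i ]≔ false) ⪯ x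
⪯-[]≔-cancel y x i b y⪯ j h with j ≟ i
... | yes refl = contradiction (trans (sym h) (lookup∘update i y false)) true≢false
... | no  j≢i  = trans (sym (lookup∘update′ j≢i x b)) (y⪯ j (trans (sym (lookup∘update′ j≢i y false)) h))

⪯-[]≔true⁻ : (z x : Vec Bool n) (i : Fin n) → z ⪯ (x [ i ]≔ true) → lookup z i ≡ false → z ⪯ x
⪯-[]≔true⁻ z x i z⪯ zᵢ = subst (_⪯ x) ([]≔-id z i zᵢ) (⪯-[]≔-cancel z x i true z⪯)

[]≔true-⪯ : (x z : Vec Bool n) (i : Fin n) → x ⪯ z → lookup z i ≡ true → (x [ i ]≔ true) ⪯ z
[]≔true-⪯ x z i x⪯z zᵢ j h with j ≟ i
... | yes refl = zᵢ
... | no  j≢i  = x⪯z j (trans (sym (lookup∘update′ j≢i x true)) h)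

unit : Fin n → Vec Bool n
unit i = zeros [ i ]≔ true

lookup-pair-≢ : ∀ {k j u : Fin n} → k ≢ j → k ≢ u → lookup (unit j [ u ]≔ true) k ≡ false
lookup-pair-≢ {k = k} {j} k≢j k≢u =
  trans (lookup∘update′ k≢u (unit j) true) (trans (lookup∘update′ k≢j zeros true) (lookup-replicate k false))

lookup-pair-j : ∀ {j u : Fin n} → j ≢ u → lookup (unit j [ u ]≔ true) j ≡ true
lookup-pair-j {j = j} j≢u = trans (lookup∘update′ j≢u (unit j) true) (lookup∘update j zeros true)

other-false : (x : Vec Bool n) (v : Fin n) → lookup x v ≡ false → x ≢ ones [ v ]≔ false →
              ∃ λ j → j ≢ v × lookup x j ≡ false
other-false x v xᵥ x≢ with any? (λ j → ¬? (j ≟ v) ×-dec (lookup x j ≟ᴮ false))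
... | yes found = found
... | no  none  = contradiction (lookup-injective same) x≢
  where
  same : ∀ k → lookup x k ≡ lookup (ones [ v ]≔ false) k
  same k with k ≟ v
  ... | yes refl = trans xᵥ (sym (lookup∘update v ones false))
  ... | no  k≢v with lookup x k in xₖ
  ...   | true  = sym (trans (lookup∘update′ k≢v ones false) (lookup-replicate k true))
  ...   | false = contradiction (k , k≢v , xₖ) none

-- Sums and counts

∑ : List A → (A → ℕ) → ℕ
∑ xs g = sum (List.map g xs)

∑-cong : ∀ (xs : List A) {g h : A → ℕ} → g ≗ h → ∑ xs g ≡ ∑ xs h
∑-cong xs g≗h = cong sum (map-cong g≗h xs)

∑-+ : ∀ (xs : List A) (g h : A → ℕ) → ∑ xs (λ x → g x + h x) ≡ ∑ xs g + ∑ xs h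
∑-+ []       g h = refl
∑-+ (x ∷ xs) g h = trans (cong (g x + h x +_) (∑-+ xs g h)) (interchange (g x) (h x) (∑ xs g) (∑ xs h))

∑-++ : ∀ (xs ys : List A) (g : A → ℕ) → ∑ (xs ++ ys) g ≡ ∑ xs g + ∑ ys g
∑-++ xs ys g = trans (cong sum (map-++ g xs ys)) (sum-++ (List.map g xs) (List.map g ys))

∑-map : ∀ {B : Set} (f : A → B) (xs : List A) (g : B → ℕ) → ∑ (List.map f xs) g ≡ ∑ xs (g ∘ f)
∑-map f xs g = cong sum (sym (map-∘ xs))

∑-≥ : ∀ {g : A → ℕ} {x xs} → x ∈ xs → g x ≤ ∑ xs g
∑-≥ (here refl)                 = m≤m+n _ _
∑-≥ {g = g} (there {x = y} x∈xs) = ≤-trans (∑-≥ x∈xs) (m≤n+m _ (g y))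

∑-zero : ∀ (xs : List A) → ∑ xs (const 0) ≡ 0
∑-zero []       = refl
∑-zero (_ ∷ xs) = ∑-zero xs

module _ {g h : A → ℕ} where

  ∑-mono-∈ : ∀ xs → (∀ {x} → x ∈ xs → g x ≤ h x) → ∑ xs g ≤ ∑ xs h
  ∑-mono-∈ []       _   = z≤n
  ∑-mono-∈ (x ∷ xs) g≤h = +-mono-≤ (g≤h (here refl)) (∑-mono-∈ xs (g≤h ∘ there))

  ∑-mono : ∀ xs → (∀ x → g x ≤ h x) → ∑ xs g ≤ ∑ xs h
  ∑-mono xs g≤h = ∑-mono-∈ xs (λ {x} _ → g≤h x)

  ∑-< : ∀ {x xs} → (∀ y → g y ≤ h y) → x ∈ xs → g x < h x → ∑ xs g < ∑ xs h
  ∑-< {xs = _ ∷ ys} g≤h (here refl) gx<hx = +-mono-<-≤ gx<hx (∑-mono ys g≤h)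
  ∑-< {xs = y ∷ _}  g≤h (there x∈)  gx<hx = +-mono-≤-< (g≤h y) (∑-< g≤h x∈ gx<hx)

  ∑-<₂ : ∀ {x y xs} → (∀ z → g z ≤ h z) → x ≢ y → x ∈ xs → y ∈ xs →
         g x < h x → g y < h y → 2 + ∑ xs g ≤ ∑ xs h
  ∑-<₂ g≤h x≢y (here refl) (here refl) _ _ = contradiction refl x≢y
  ∑-<₂ {xs = z ∷ zs} g≤h x≢y (here refl) (there y∈) gz<hz gy<hy =
    subst (_≤ h z + ∑ zs h) (cong suc (+-suc (g z) (∑ zs g))) (+-mono-≤ gz<hz (∑-< g≤h y∈ gy<hy))
  ∑-<₂ {xs = z ∷ zs} g≤h x≢y (there x∈) (here refl) gx<hx gz<hz =
    subst (_≤ h z + ∑ zs h) (cong suc (+-suc (g z) (∑ zs g))) (+-mono-≤ gz<hz (∑-< g≤h x∈ gx<hx))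
  ∑-<₂ {xs = z ∷ zs} g≤h x≢y (there x∈) (there y∈) gx<hx gy<hy =
    subst (_≤ h z + ∑ zs h) (trans (+-suc (g z) _) (cong suc (+-suc (g z) (∑ zs g))))
      (+-mono-≤ (g≤h z) (∑-<₂ g≤h x≢y x∈ y∈ gx<hx gy<hy))

  ∑-≤-suc : DecidableEquality A → ∀ {x xs} → Unique xs →
            (∀ y → y ≢ x → g y ≤ h y) → g x ≤ suc (h x) → ∑ xs g ≤ suc (∑ xs h)
  ∑-≤-suc _≟ᴬ_ [] _ _ = z≤n
  ∑-≤-suc _≟ᴬ_ {x} {y ∷ ys} (y∉ys ∷ ys!) g≤h gx≤ with y ≟ᴬ x
  ... | yes refl = +-mono-≤ gx≤ (∑-mono-∈ ys λ z∈ → g≤h _ λ z≡y → All.lookup y∉ys z∈ (sym z≡y))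
  ... | no  y≢x  = subst (g y + ∑ ys g ≤_) (+-suc (h y) (∑ ys h))
                     (+-mono-≤ (g≤h y y≢x) (∑-≤-suc _≟ᴬ_ ys! g≤h gx≤))

count≡∑ : ∀ (p : A → Bool) xs → count p xs ≡ ∑ xs (bit ∘ p)
count≡∑ p []       = refl
count≡∑ p (x ∷ xs) with p x
... | true  = cong suc (count≡∑ p xs)
... | false = count≡∑ p xs

module _ {P : Pred A 0ℓ} (P? : Decidable P) where

  count-pos : ∀ {x xs} → x ∈ xs → P x → 0 < count (does ∘ P?) xs
  count-pos {x} {xs} x∈xs px rewrite count≡∑ (does ∘ P?) xs =
    subst (_≤ ∑ xs (bit ∘ does ∘ P?)) (cong bit (dec-true (P? x) px)) (∑-≥ x∈xs)

  count-zero : ∀ xs → (∀ x → ¬ P x) → count (does ∘ P?) xs ≡ 0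
  count-zero []       _  = refl
  count-zero (x ∷ xs) ¬P with P? x
  ... | yes px = contradiction px (¬P x)
  ... | no  _  = count-zero xs ¬P

module _ {P Q : Pred A 0ℓ} (P? : Decidable P) (Q? : Decidable Q) where

  private
    bit-mono : ∀ {x} → (P x → Q x) → bit (does (P? x)) ≤ bit (does (Q? x))
    bit-mono {x} P⇒Q with P? x | Q? x
    ... | yes px | no ¬qx = contradiction (P⇒Q px) ¬qx
    ... | yes _  | yes _  = ≤-refl
    ... | no  _  | _      = z≤n

  count-mono : ∀ xs → (∀ {x} → P x → Q x) → count (does ∘ P?) xs ≤ count (does ∘ Q?) xs
  count-mono xs P⇒Q rewrite count≡∑ (does ∘ P?) xs | count≡∑ (does ∘ Q?) xs =
    ∑-mono xs (λ _ → bit-mono P⇒Q)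

  count-< : ∀ {x xs} → (∀ {y} → P y → Q y) → x ∈ xs → Q x → ¬ P x →
            count (does ∘ P?) xs < count (does ∘ Q?) xs
  count-< {x} {xs} P⇒Q x∈xs qx ¬px rewrite count≡∑ (does ∘ P?) xs | count≡∑ (does ∘ Q?) xs =
    ∑-< (λ _ → bit-mono P⇒Q) x∈xs strict
    where
    strict : bit (does (P? x)) < bit (does (Q? x))
    strict with P? x | Q? x
    ... | yes px | _      = contradiction px ¬px
    ... | no _   | yes _  = s≤s z≤n
    ... | no _   | no ¬qx = contradiction qx ¬qx

  count-≤-suc : DecidableEquality A → ∀ {x xs} → Unique xs → (∀ {y} → y ≢ x → P y → Q y) →
                count (does ∘ P?) xs ≤ suc (count (does ∘ Q?) xs)
  count-≤-suc _≟ᴬ_ {x} {xs} xs! P⇒Q rewrite count≡∑ (does ∘ P?) xs | count≡∑ (does ∘ Q?) xs =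
    ∑-≤-suc _≟ᴬ_ xs! (λ _ y≢x → bit-mono (P⇒Q y≢x)) (at-most-one (does (P? x)) (does (Q? x)))
    where
    at-most-one : ∀ a b → bit a ≤ suc (bit b)
    at-most-one false _     = z≤n
    at-most-one true  false = ≤-refl
    at-most-one true  true  = s≤s z≤n

count-≤-1 : ∀ {P : Pred A 0ℓ} (P? : Decidable P) → DecidableEquality A → ∀ {x xs} → Unique xs →
            (∀ {y} → P y → y ≡ x) → count (does ∘ P?) xs ≤ 1
count-≤-1 P? _≟ᴬ_ {xs = xs} xs! P⇒≡x =
  subst (λ k → count (does ∘ P?) xs ≤ suc k) (count-zero none xs (λ _ ()))
    (count-≤-suc P? none _≟ᴬ_ xs! (λ y≢x py → y≢x (P⇒≡x py)))
  where
  none : Decidable (λ (_ : A) → ⊥)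
  none _ = no (λ ())

bits-pos : ∀ {R S : Set} (R? : Dec R) (S? : Dec S) → R ⊎ S → 1 ≤ bit (does R?) + bit (does S?)
bits-pos R? S? (inj₁ r) rewrite dec-true R? r = s≤s z≤n
bits-pos R? S? (inj₂ s) rewrite dec-true S? s = m≤n+m 1 _

bit-≤ : ∀ {P R S : Set} (P? : Dec P) (R? : Dec R) (S? : Dec S) →
        (P → R ⊎ S) → bit (does P?) ≤ bit (does R?) + bit (does S?)
bit-≤ (yes p) R? S? P⇒R⊎S = bits-pos R? S? (P⇒R⊎S p)
bit-≤ (no _)  _  _  _      = z≤n

bits-≤ : ∀ {P Q R S : Set} (P? : Dec P) (Q? : Dec Q) (R? : Dec R) (S? : Dec S) → ¬ (P × Q) →
         (P ⊎ Q → R ⊎ S) → bit (does P?) + bit (does Q?) ≤ bit (does R?) + bit (does S?)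
bits-≤ (yes p) (yes q) _  _  ¬both _   = contradiction (p , q) ¬both
bits-≤ (no _)  (no _)  _  _  _     _   = z≤n
bits-≤ (yes p) (no _)  R? S? _     imp = bits-pos R? S? (imp (inj₁ p))
bits-≤ (no _)  (yes q) R? S? _     imp = bits-pos R? S? (imp (inj₂ q))

bits-< : ∀ {P Q R S : Set} (P? : Dec P) (Q? : Dec Q) (R? : Dec R) (S? : Dec S) → ¬ Q → R →
         (P → S) → bit (does P?) + bit (does Q?) < bit (does R?) + bit (does S?)
bits-< _       (yes q) _       _  ¬q _ _   = contradiction q ¬q
bits-< _       (no _)  (no ¬r) _  _  r _   = contradiction r ¬r
bits-< (no _)  (no _)  (yes _) _  _  _ _   = s≤s z≤n
bits-< (yes p) (no _)  (yes _) S? _  _ P⇒S rewrite dec-true S? (P⇒S p) = ≤-refl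

∈-allVecs : (x : Vec Bool n) → x ∈ allVecs n
∈-allVecs []          = here refl
∈-allVecs (false ∷ x) = ∈-++⁺ˡ (∈-map⁺ (false ∷_) (∈-allVecs x))
∈-allVecs {suc n} (true ∷ x) =
  ∈-++⁺ʳ (List.map (false ∷_) (allVecs n)) (∈-map⁺ (true ∷_) (∈-allVecs x))

allVecs-unique : ∀ n → Unique (allVecs n)
allVecs-unique zero    = All.[] ∷ []
allVecs-unique (suc n) =
  Unique.++⁺ (Unique.map⁺ ∷-injectiveʳ (allVecs-unique n)) (Unique.map⁺ ∷-injectiveʳ (allVecs-unique n))
             disjoint
  where
  ∷-injectiveʳ : ∀ {b} {x y : Vec Bool n} → b ∷ x ≡ b ∷ y → x ≡ y
  ∷-injectiveʳ = proj₂ ∘ ∷-injective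
  disjoint : Disjoint (List.map (false ∷_) (allVecs n)) (List.map (true ∷_) (allVecs n))
  disjoint (v∈₀ , v∈₁) with ∈-map⁻ (false ∷_) v∈₀ | ∈-map⁻ (true ∷_) v∈₁
  ... | _ , _ , refl | _ , _ , ()

∑-allVecs-suc : ∀ n (g : Vec Bool (suc n) → ℕ) →
                ∑ (allVecs (suc n)) g ≡ ∑ (allVecs n) (g ∘ (false ∷_)) + ∑ (allVecs n) (g ∘ (true ∷_))
∑-allVecs-suc n g = trans (∑-++ (List.map (false ∷_) (allVecs n)) _ g)
  (cong₂ _+_ (∑-map (false ∷_) (allVecs n) g) (∑-map (true ∷_) (allVecs n) g))

∑-complement : ∀ n (g : Vec Bool n → ℕ) → ∑ (allVecs n) (g ∘ complement) ≡ ∑ (allVecs n) g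
∑-complement zero    g = refl
∑-complement (suc n) g = begin
  ∑ (allVecs (suc n)) (g ∘ complement)
    ≡⟨ ∑-allVecs-suc n (g ∘ complement) ⟩
  ∑ (allVecs n) ((g ∘ (true ∷_)) ∘ complement) + ∑ (allVecs n) ((g ∘ (false ∷_)) ∘ complement)
    ≡⟨ cong₂ _+_ (∑-complement n (g ∘ (true ∷_))) (∑-complement n (g ∘ (false ∷_))) ⟩
  ∑ (allVecs n) (g ∘ (true ∷_)) + ∑ (allVecs n) (g ∘ (false ∷_))
    ≡⟨ +-comm (∑ (allVecs n) (g ∘ (true ∷_))) _ ⟩
  ∑ (allVecs n) (g ∘ (false ∷_)) + ∑ (allVecs n) (g ∘ (true ∷_))
    ≡⟨ ∑-allVecs-suc n g ⟨
  ∑ (allVecs (suc n)) g ∎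
  where open ≡-Reasoning

edgeSum : Fin n → (Vec Bool n → ℕ) → Vec Bool n → ℕ
edgeSum v g x = if lookup x v then 0 else g x + g (x [ v ]≔ true)

∑-edgeSum : ∀ n (v : Fin n) (g : Vec Bool n → ℕ) → ∑ (allVecs n) g ≡ ∑ (allVecs n) (edgeSum v g)
∑-edgeSum (suc n) fzero g = begin
  ∑ (allVecs (suc n)) g
    ≡⟨ ∑-allVecs-suc n g ⟩
  ∑ (allVecs n) (g ∘ (false ∷_)) + ∑ (allVecs n) (g ∘ (true ∷_))
    ≡⟨ ∑-+ (allVecs n) (g ∘ (false ∷_)) (g ∘ (true ∷_)) ⟨
  ∑ (allVecs n) (edgeSum fzero g ∘ (false ∷_))
    ≡⟨ +-identityʳ _ ⟨
  ∑ (allVecs n) (edgeSum fzero g ∘ (false ∷_)) + 0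
    ≡⟨ cong (∑ (allVecs n) (edgeSum fzero g ∘ (false ∷_)) +_) (∑-zero (allVecs n)) ⟨
  ∑ (allVecs n) (edgeSum fzero g ∘ (false ∷_)) + ∑ (allVecs n) (edgeSum fzero g ∘ (true ∷_))
    ≡⟨ ∑-allVecs-suc n (edgeSum fzero g) ⟨
  ∑ (allVecs (suc n)) (edgeSum fzero g) ∎
  where open ≡-Reasoning
∑-edgeSum (suc n) (fsuc v) g = begin
  ∑ (allVecs (suc n)) g
    ≡⟨ ∑-allVecs-suc n g ⟩
  ∑ (allVecs n) (g ∘ (false ∷_)) + ∑ (allVecs n) (g ∘ (true ∷_))
    ≡⟨ cong₂ _+_ (∑-edgeSum n v (g ∘ (false ∷_))) (∑-edgeSum n v (g ∘ (true ∷_))) ⟩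
  ∑ (allVecs n) (edgeSum v (g ∘ (false ∷_))) + ∑ (allVecs n) (edgeSum v (g ∘ (true ∷_)))
    ≡⟨ ∑-allVecs-suc n (edgeSum (fsuc v) g) ⟨
  ∑ (allVecs (suc n)) (edgeSum (fsuc v) g) ∎
  where open ≡-Reasoning

reflects-≡true : ∀ {P : Set} {b} → b ≡ true ⇔ P → Reflects P b
reflects-≡true {b = false} b⇔P = ofⁿ (λ p → contradiction (sym (from b⇔P p)) true≢false)
reflects-≡true {b = true}  b⇔P = ofʸ (to b⇔P refl)

∷-⪯ : ∀ {a b} {x y : Vec Bool n} → (a ≡ true → b ≡ true) → x ⪯ y → (a ∷ x) ⪯ (b ∷ y)
∷-⪯ a⇒b _   fzero    = a⇒b
∷-⪯ _   x⪯y (fsuc i) = x⪯y i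

⪯ᵇ⇔⪯ : (x y : Vec Bool n) → x ⪯ᵇ y ≡ true ⇔ x ⪯ y
⪯ᵇ⇔⪯ []          []          = mk⇔ (λ _ ()) (λ _ → refl)
⪯ᵇ⇔⪯ (false ∷ x) (b ∷ y)     = mk⇔ (∷-⪯ (λ ()) ∘ to (⪯ᵇ⇔⪯ x y))        (λ p → from (⪯ᵇ⇔⪯ x y) (p ∘ fsuc))
⪯ᵇ⇔⪯ (true ∷ x)  (true ∷ y)  = mk⇔ (∷-⪯ (λ _ → refl) ∘ to (⪯ᵇ⇔⪯ x y)) (λ p → from (⪯ᵇ⇔⪯ x y) (p ∘ fsuc))
⪯ᵇ⇔⪯ (true ∷ x)  (false ∷ y) = mk⇔ (λ ()) (λ p → contradiction (sym (p fzero refl)) true≢false)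

=ᵇ⇔≡ : (x y : Vec Bool n) → x =ᵇ y ≡ true ⇔ x ≡ y
=ᵇ⇔≡ []          []          = mk⇔ (λ _ → refl) (λ _ → refl)
=ᵇ⇔≡ (false ∷ x) (false ∷ y) = mk⇔ (cong (false ∷_) ∘ to (=ᵇ⇔≡ x y))
                                   (from (=ᵇ⇔≡ x y) ∘ proj₂ ∘ ∷-injective)
=ᵇ⇔≡ (true ∷ x)  (true ∷ y)  = mk⇔ (cong (true ∷_) ∘ to (=ᵇ⇔≡ x y))
                                   (from (=ᵇ⇔≡ x y) ∘ proj₂ ∘ ∷-injective)
=ᵇ⇔≡ (false ∷ x) (true ∷ y)  = mk⇔ (λ ()) (λ ())
=ᵇ⇔≡ (true ∷ x)  (false ∷ y) = mk⇔ (λ ()) (λ ())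

all-allVecs⇔ : (p : Vec Bool n → Bool) → all p (allVecs n) ≡ true ⇔ (∀ x → p x ≡ true)
all-allVecs⇔ {n} p = mk⇔
  (λ h x → to T-≡ (All.lookup (all⁺ p (allVecs n) (from T-≡ h)) (∈-allVecs x)))
  (λ h → to T-≡ (all⁻ p {allVecs n} (All.tabulate (λ {x} _ → from T-≡ (h x)))))

any-allVecs⇔ : (p : Vec Bool n → Bool) → any p (allVecs n) ≡ true ⇔ (∃ λ x → p x ≡ true)
any-allVecs⇔ {n} p = mk⇔
  (λ h → let x , px = satisfied (any⁻ p (allVecs n) (from T-≡ h)) in x , to T-≡ px)
  (λ (x , px) → to T-≡ (any⁺ p (lose (∈-allVecs x) (from T-≡ px))))

MaxFalse MinTrue Extremal : BoolFn n → Vec Bool n → Set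
MaxFalse f x = f x ≡ false × (∀ y → x ⪯ y → f y ≡ false → y ≡ x)
MinTrue  f x = f x ≡ true  × (∀ y → y ⪯ x → f y ≡ true  → y ≡ x)
Extremal f x = MaxFalse f x ⊎ MinTrue f x

∨-implication : ∀ {a b c} → not (a ∧ b) ∨ c ≡ true ⇔ (a ≡ true → b ≡ true → c ≡ true)
∨-implication {true}  {true}  = mk⇔ (λ h _ _ → h) (λ h → h refl refl)
∨-implication {true}  {false} = mk⇔ (λ _ _ ()) (λ _ → refl)
∨-implication {false}         = mk⇔ (λ _ ()) (λ _ → refl)

maxFalseᵇ⇔ : (f : BoolFn n) (x : Vec Bool n) → maxFalseᵇ f x ≡ true ⇔ MaxFalse f x
maxFalseᵇ⇔ f x = mk⇔ sound complete
  where
  sound : maxFalseᵇ f x ≡ true → MaxFalse f x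
  sound h with f x in fx
  ... | false = refl , λ y x⪯y fy →
    to (=ᵇ⇔≡ y x) (to ∨-implication (to (all-allVecs⇔ _) h y) (from (⪯ᵇ⇔⪯ x y) x⪯y) (cong not fy))
  complete : MaxFalse f x → maxFalseᵇ f x ≡ true
  complete (fx , maximal) rewrite fx = from (all-allVecs⇔ _) λ y → from ∨-implication λ x⪯y fy →
    from (=ᵇ⇔≡ y x) (maximal y (to (⪯ᵇ⇔⪯ x y) x⪯y) (not-injective fy))

minTrueᵇ⇔ : (f : BoolFn n) (x : Vec Bool n) → minTrueᵇ f x ≡ true ⇔ MinTrue f x
minTrueᵇ⇔ f x = mk⇔ sound complete
  where
  sound : minTrueᵇ f x ≡ true → MinTrue f x
  sound h with f x in fx
  ... | true = refl , λ y y⪯x fy →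
    to (=ᵇ⇔≡ y x) (to ∨-implication (to (all-allVecs⇔ _) h y) (from (⪯ᵇ⇔⪯ y x) y⪯x) fy)
  complete : MinTrue f x → minTrueᵇ f x ≡ true
  complete (fx , minimal) rewrite fx = from (all-allVecs⇔ _) λ y → from ∨-implication λ y⪯x fy →
    from (=ᵇ⇔≡ y x) (minimal y (to (⪯ᵇ⇔⪯ y x) y⪯x) fy)

extremal? : (f : BoolFn n) → Decidable (Extremal f)
extremal? f x = (maxFalseᵇ f x ∨ minTrueᵇ f x) because reflects-≡true (mk⇔ sound complete)
  where
  sound : maxFalseᵇ f x ∨ minTrueᵇ f x ≡ true → Extremal f x
  sound h with maxFalseᵇ f x in max
  ... | true  = inj₁ (to (maxFalseᵇ⇔ f x) max)
  ... | false = inj₂ (to (minTrueᵇ⇔ f x) h)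
  complete : Extremal f x → maxFalseᵇ f x ∨ minTrueᵇ f x ≡ true
  complete (inj₁ max) rewrite from (maxFalseᵇ⇔ f x) max = refl
  complete (inj₂ min) rewrite from (minTrueᵇ⇔ f x) min with maxFalseᵇ f x
  ... | true  = refl
  ... | false = refl

χ : BoolFn n → Vec Bool n → ℕ
χ f x = bit (does (extremal? f x))

numExtremal≡∑χ : (f : BoolFn n) → numExtremal f ≡ ∑ (allVecs n) (χ f)
numExtremal≡∑χ f = count≡∑ (does ∘ extremal? f) (allVecs _)

χ≡0 : {f : BoolFn n} {x : Vec Bool n} → ¬ Extremal f x → χ f x ≡ 0
χ≡0 {f = f} {x} ¬ext = cong bit (dec-false (extremal? f x) ¬ext)

-- Relevant variables, restrictions and duals

-- Defs' Relevant, with a witness point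
record Essential (f : BoolFn n) (i : Fin n) : Set where
  constructor flipsAt
  field
    point  : Vec Bool n
    differ : f (point [ i ]≔ false) ≢ f (point [ i ]≔ true)

Inessential : BoolFn n → Fin n → Set
Inessential f i = ∀ x → f (x [ i ]≔ false) ≡ f (x [ i ]≔ true)

inessential⇒¬essential : (f : BoolFn n) (i : Fin n) → Inessential f i → ¬ Essential f i
inessential⇒¬essential f i same (flipsAt x differ) = differ (same x)

¬essential⇒inessential : (f : BoolFn n) (i : Fin n) → ¬ Essential f i → Inessential f i
¬essential⇒inessential f i ¬ess x with f (x [ i ]≔ false) ≟ᴮ f (x [ i ]≔ true)
... | yes same  = same
... | no differ = contradiction (flipsAt x differ) ¬ess

insertAt-[]≔ : ∀ {m} (z : Vec Bool m) (i : Fin (suc m)) a b → insertAt z i a [ i ]≔ b ≡ insertAt z i b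
insertAt-[]≔ z       fzero    a b = refl
insertAt-[]≔ (c ∷ z) (fsuc i) a b = cong (c ∷_) (insertAt-[]≔ z i a b)

[]≔-via-removeAt : ∀ {m} (x : Vec Bool (suc m)) i b → x [ i ]≔ b ≡ insertAt (removeAt x i) i b
[]≔-via-removeAt x i b = trans (cong (_[ i ]≔ b) (sym (insertAt-removeAt x i)))
                              (insertAt-[]≔ (removeAt x i) i (lookup x i) b)

differ⇔ : ∀ a b → not (if a then b else not b) ≡ true ⇔ a ≢ b
differ⇔ true  true  = mk⇔ (λ ()) (λ differ → contradiction refl differ)
differ⇔ true  false = mk⇔ (λ _ ()) (λ _ → refl)
differ⇔ false true  = mk⇔ (λ _ ()) (λ _ → refl)
differ⇔ false false = mk⇔ (λ ()) (λ differ → contradiction refl differ)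

relevantᵇ⇔ : (f : BoolFn n) (i : Fin n) → relevantᵇ f i ≡ true ⇔ Essential f i
relevantᵇ⇔ {suc m} f i = mk⇔ sound complete
  where
  sound : relevantᵇ f i ≡ true → Essential f i
  sound h with to (any-allVecs⇔ _) h
  ... | z , differ = flipsAt (insertAt z i false) λ same →
    to (differ⇔ _ _) differ (trans (sym (flip false)) (trans same (flip true)))
    where
    flip : ∀ b → f (insertAt z i false [ i ]≔ b) ≡ f (insertAt z i b)
    flip b = cong f (insertAt-[]≔ z i false b)
  complete : Essential f i → relevantᵇ f i ≡ true
  complete (flipsAt x differ) = from (any-allVecs⇔ _) (removeAt x i , from (differ⇔ _ _) λ same →
    differ (trans (cong f ([]≔-via-removeAt x i false))
           (trans same (sym (cong f ([]≔-via-removeAt x i true))))))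

relevant? : (f : BoolFn n) → Decidable (Essential f)
relevant? f i = relevantᵇ f i because reflects-≡true (relevantᵇ⇔ f i)

-- f_{|x_i = a}, kept as a function of all n variables (unlike restrict, which drops x_i)
infixl 5 _∣_≔_
_∣_≔_ : BoolFn n → Fin n → Bool → BoolFn n
(f ∣ i ≔ a) x = f (x [ i ]≔ a)

∣≔-positive : {f : BoolFn n} → Positive f → ∀ i a → Positive (f ∣ i ≔ a)
∣≔-positive pos i a x y fx x⪯y = pos _ _ fx ([]≔-mono x y x⪯y i a)

∣≔-inessential : (f : BoolFn n) (i : Fin n) (a : Bool) → Inessential (f ∣ i ≔ a) i
∣≔-inessential f i a x = trans (cong f ([]≔-idempotent x i)) (sym (cong f ([]≔-idempotent x i)))

inessential-[]≔ : (f : BoolFn n) (i : Fin n) → Inessential f i → ∀ y b → f (y [ i ]≔ b) ≡ f y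
inessential-[]≔ f i same y b =
  trans (atFalse b) (trans (sym (atFalse (lookup y i))) (cong f ([]≔-lookup y i)))
  where
  atFalse : ∀ c → f (y [ i ]≔ c) ≡ f (y [ i ]≔ false)
  atFalse false = refl
  atFalse true  = sym (same y)

essential-∣≔ : {f : BoolFn n} {i j : Fin n} {a : Bool} → Essential (f ∣ i ≔ a) j → Essential f j
essential-∣≔ {f = f} {i} {j} {a} (flipsAt x differ) with j ≟ i
... | yes refl = contradiction (∣≔-inessential f i a x) differ
... | no  j≢i  = flipsAt (x [ i ]≔ a) λ same →
  differ (trans (cong f (sym (swap false))) (trans same (cong f (swap true))))
  where
  swap : ∀ b → (x [ i ]≔ a) [ j ]≔ b ≡ (x [ j ]≔ b) [ i ]≔ a
  swap b = []≔-commutes x i j (j≢i ∘ sym)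

essential-≗ : {f g : BoolFn n} {j : Fin n} → f ≗ g → Essential f j → Essential g j
essential-≗ f≗g (flipsAt x differ) = flipsAt x λ same → differ (trans (f≗g _) (trans same (sym (f≗g _))))

constant-if-inessential : (g : BoolFn n) → (∀ i → Inessential g i) → g ≗ const (g zeros)
constant-if-inessential {zero}  g _    []      = refl
constant-if-inessential {suc n} g same (b ∷ x) =
  trans (sym (inessential-[]≔ g fzero (same fzero) (b ∷ x) false))
        (constant-if-inessential (g ∘ (false ∷_)) (λ i y → same (fsuc i) (false ∷ y)) x)

dual : BoolFn n → BoolFn n
dual f = not ∘ f ∘ complement

dual-positive : {f : BoolFn n} → Positive f → Positive (dual f)
dual-positive {f = f} pos x y dfx x⪯y with f (complement y) in fcy
... | false = refl
... | true  = contradiction (trans (sym (cong not (pos _ _ fcy (complement-antitone x y x⪯y)))) dfx) λ ()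

dual-involutive : (f : BoolFn n) → dual (dual f) ≗ f
dual-involutive f x = trans (not-involutive _) (cong f (complement-involutive x))

dual-[]≔ : (f : BoolFn n) (x : Vec Bool n) (i : Fin n) (b : Bool) →
           dual f (complement x [ i ]≔ b) ≡ not (f (x [ i ]≔ not b))
dual-[]≔ f x i b =
  cong (not ∘ f) (trans (map-[]≔ not (complement x) i) (cong (_[ i ]≔ not b) (complement-involutive x)))

dual-∣≔ : (f : BoolFn n) (i : Fin n) (a : Bool) → dual f ∣ i ≔ a ≗ dual (f ∣ i ≔ not a)
dual-∣≔ f i a x = cong (not ∘ f) (map-[]≔ not x i)

essential-dual : {f : BoolFn n} {j : Fin n} → Essential f j → Essential (dual f) j
essential-dual {f = f} {j} (flipsAt x differ) = flipsAt (complement x) λ same →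
  differ (not-injective (trans (sym (dual-[]≔ f x j true)) (trans (sym same) (dual-[]≔ f x j false))))

essential-dual⁻ : {f : BoolFn n} {j : Fin n} → Essential (dual f) j → Essential f j
essential-dual⁻ {f = f} = essential-≗ (dual-involutive f) ∘ essential-dual

numRelevant-mono : {f g : BoolFn n} → (∀ {j} → Essential f j → Essential g j) → numRelevant f ≤ numRelevant g
numRelevant-mono {n} {f} {g} = count-mono (relevant? f) (relevant? g) (allFin n)

numRelevant-≤-suc : {f g : BoolFn n} {v : Fin n} → (∀ {w} → w ≢ v → Essential f w → Essential g w) →
                    numRelevant f ≤ suc (numRelevant g)
numRelevant-≤-suc {n} {f} {g} = count-≤-suc (relevant? f) (relevant? g) _≟_ (Unique.allFin⁺ n)

numRelevant-∣≔-< : {f : BoolFn n} {v : Fin n} (a : Bool) → Essential f v →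
                   numRelevant (f ∣ v ≔ a) < numRelevant f
numRelevant-∣≔-< {f = f} {v} a ess =
  count-< (relevant? (f ∣ v ≔ a)) (relevant? f) essential-∣≔ (∈-allFin v) ess
    (inessential⇒¬essential (f ∣ v ≔ a) v (∣≔-inessential f v a))

numRelevant-pos : {f : BoolFn n} {i : Fin n} → Essential f i → 0 < numRelevant f
numRelevant-pos {f = f} {i} = count-pos (relevant? f) (∈-allFin i)

numRelevant-zero : (f : BoolFn n) → (∀ i → Inessential f i) → numRelevant f ≡ 0
numRelevant-zero {n} f same = count-zero (relevant? f) (allFin n) (λ i → inessential⇒¬essential f i (same i))

numRelevant-dual : (f : BoolFn n) → numRelevant (dual f) ≡ numRelevant f
numRelevant-dual f =
  ≤-antisym (numRelevant-mono {f = dual f} {f} essential-dual⁻) (numRelevant-mono {f = f} {dual f} essential-dual)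

essential-or-constant : (f : BoolFn n) → (∃ λ i → Essential f i) ⊎ f ≗ const (f zeros)
essential-or-constant f with any? (relevant? f)
... | yes ess  = inj₁ ess
... | no ¬ess = inj₂ (constant-if-inessential f (λ i → ¬essential⇒inessential f i (¬ess ∘ (i ,_))))

module _ {f : BoolFn n} {x : Vec Bool n} where

  maxFalse-dual : MaxFalse (dual f) x → MinTrue f (complement x)
  maxFalse-dual (dfx , maximal) = not-injective dfx , λ y y⪯x̄ fy →
    trans (sym (complement-involutive y)) (cong complement (maximal (complement y)
      (subst (_⪯ complement y) (complement-involutive x) (complement-antitone y (complement x) y⪯x̄))
      (cong not (trans (cong f (complement-involutive y)) fy))))

  minTrue-dual : MinTrue (dual f) x → MaxFalse f (complement x)
  minTrue-dual (dfx , minimal) = not-injective dfx , λ y x̄⪯y fy →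
    trans (sym (complement-involutive y)) (cong complement (minimal (complement y)
      (subst (complement y ⪯_) (complement-involutive x) (complement-antitone (complement x) y x̄⪯y))
      (cong not (trans (cong f (complement-involutive y)) fy))))

  extremal-dual : Extremal (dual f) x → Extremal f (complement x)
  extremal-dual (inj₁ max) = inj₂ (maxFalse-dual max)
  extremal-dual (inj₂ min) = inj₁ (minTrue-dual min)

extremal-≗ : {f g : BoolFn n} {x : Vec Bool n} → f ≗ g → Extremal f x → Extremal g x
extremal-≗ f≗g (inj₁ (fx , maximal)) =
  inj₁ (trans (sym (f≗g _)) fx , λ y x⪯y gy → maximal y x⪯y (trans (f≗g y) gy))
extremal-≗ f≗g (inj₂ (fx , minimal)) =
  inj₂ (trans (sym (f≗g _)) fx , λ y y⪯x gy → minimal y y⪯x (trans (f≗g y) gy))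

extremal-dual⁻ : {f : BoolFn n} {x : Vec Bool n} → Extremal f (complement x) → Extremal (dual f) x
extremal-dual⁻ {f = f} {x} ext = subst (Extremal (dual f)) (complement-involutive x)
  (extremal-dual (extremal-≗ (λ y → sym (dual-involutive f y)) ext))

does-cong : ∀ {P Q : Set} (P? : Dec P) (Q? : Dec Q) → (P → Q) → (Q → P) → does P? ≡ does Q?
does-cong (yes p) Q? P⇒Q _   = sym (dec-true Q? (P⇒Q p))
does-cong (no ¬p) Q? _   Q⇒P = sym (dec-false Q? (¬p ∘ Q⇒P))

numExtremal-dual : (f : BoolFn n) → numExtremal (dual f) ≡ numExtremal f
numExtremal-dual {n} f = begin
  numExtremal (dual f)              ≡⟨ numExtremal≡∑χ (dual f) ⟩
  ∑ (allVecs n) (χ (dual f))        ≡⟨ ∑-cong (allVecs n) (λ x → cong bit (does-cong (extremal? (dual f) x)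
                                         (extremal? f (complement x)) extremal-dual extremal-dual⁻)) ⟩
  ∑ (allVecs n) (χ f ∘ complement)  ≡⟨ ∑-complement n (χ f) ⟩
  ∑ (allVecs n) (χ f)               ≡⟨ numExtremal≡∑χ f ⟨
  numExtremal f                     ∎
  where open ≡-Reasoning

-- Defs' Split, phrased with _∣_≔_ instead of restrict
Split′ : BoolFn n → Set
Split′ f = ∃ λ u → (f ∣ u ≔ false ≗ const false) ⊎ (f ∣ u ≔ true ≗ const true)

constant? : (g : BoolFn n) (b : Bool) → Dec (g ≗ const b)
constant? {n} g b = map′ (λ all x → All.lookup all (∈-allVecs x)) (λ g≗b → All.tabulate λ {x} _ → g≗b x)
                         (All.all? (λ x → g x ≟ᴮ b) (allVecs n))

split? : (f : BoolFn n) → Dec (Split′ f)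
split? f = any? (λ u → constant? (f ∣ u ≔ false) false ⊎-dec constant? (f ∣ u ≔ true) true)

split-dual⁻ : (f : BoolFn n) → Split′ (dual f) → Split′ f
split-dual⁻ f (u , inj₁ ≗false) =
  u , inj₂ λ y → not-injective (trans (sym (dual-[]≔ f y u false)) (≗false (complement y)))
split-dual⁻ f (u , inj₂ ≗true)  =
  u , inj₁ λ y → not-injective (trans (sym (dual-[]≔ f y u true)) (≗true (complement y)))

-- Positive functions

positive-false : {f : BoolFn n} → Positive f → ∀ x y → x ⪯ y → f y ≡ false → f x ≡ false
positive-false {f = f} pos x y x⪯y fy with f x in fx
... | false = refl
... | true  = contradiction (trans (sym (pos x y fx x⪯y)) fy) true≢false

positive-forces : {f : BoolFn n} → Positive f → ∀ z w i →
                  f z ≡ true → z ⪯ (w [ i ]≔ true) → f w ≡ false → lookup z i ≡ true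
positive-forces pos z w i fz z⪯ fw with lookup z i in zᵢ
... | true  = refl
... | false = contradiction (trans (sym fz) (positive-false pos z w (⪯-[]≔true⁻ z w i z⪯ zᵢ) fw)) true≢false

positive-flip : {f : BoolFn n} → Positive f → ∀ {i} → Essential f i →
                ∃ λ x → lookup x i ≡ false × f x ≡ false × f (x [ i ]≔ true) ≡ true
positive-flip {f = f} pos {i} (flipsAt x differ) with f (x [ i ]≔ false) in f₀ | f (x [ i ]≔ true) in f₁
... | false | true  = x [ i ]≔ false , lookup∘update i x false , f₀ , trans (cong f ([]≔-idempotent x i)) f₁
... | false | false = contradiction refl differ
... | true  | true  = contradiction refl differ
... | true  | false = contradiction (trans (sym f₁) (pos _ _ f₀ ([]≔false-⪯-[]≔true x i))) λ ()

∷-positive : {f : BoolFn (suc n)} → Positive f → ∀ b → Positive (f ∘ (b ∷_))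
∷-positive pos b x y fx x⪯y = pos _ _ fx (∷-⪯ (λ h → h) x⪯y)

maxFalse-above : {f : BoolFn n} → Positive f → ∀ x → f x ≡ false → ∃ λ F → MaxFalse f F × x ⪯ F
maxFalse-above {zero} pos [] fx = [] , (fx , λ { [] _ _ → refl }) , λ ()
maxFalse-above {suc n} {f} pos (b ∷ x) fx with f (true ∷ x) in fx₁
... | false with maxFalse-above (∷-positive pos true) x fx₁
...   | F , (fF , maximal) , x⪯F = true ∷ F , (fF , above) , ∷-⪯ (λ _ → refl) x⪯F
  where
  above : ∀ y → (true ∷ F) ⪯ y → f y ≡ false → y ≡ true ∷ F
  above (c ∷ y) F⪯y fy with F⪯y fzero refl
  ... | refl = cong (true ∷_) (maximal y (F⪯y ∘ fsuc) fy)
maxFalse-above {suc n} {f} pos (true ∷ x) fx | true = contradiction (trans (sym fx₁) fx) true≢false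
maxFalse-above {suc n} {f} pos (false ∷ x) fx | true with maxFalse-above (∷-positive pos false) x fx
... | F , (fF , maximal) , x⪯F = false ∷ F , (fF , above) , ∷-⪯ (λ ()) x⪯F
  where
  above : ∀ y → (false ∷ F) ⪯ y → f y ≡ false → y ≡ false ∷ F
  above (false ∷ y) F⪯y fy = cong (false ∷_) (maximal y (F⪯y ∘ fsuc) fy)
  above (true ∷ y)  F⪯y fy =
    contradiction (trans (sym fy) (pos _ _ fx₁ (∷-⪯ (λ _ → refl) (⪯-trans x F y x⪯F (F⪯y ∘ fsuc)))))
                  λ ()

unsplit-unit : {f : BoolFn n} → Positive f → ¬ Split′ f → ∀ u → f (unit u) ≡ false
unsplit-unit {f = f} pos unsplit u with f (unit u) in fu
... | false = refl
... | true  = contradiction (u , inj₂ λ x → pos _ _ fu ([]≔-mono zeros x (zeros-⪯ x) u true)) unsplit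

unsplit-ones : {f : BoolFn n} → Positive f → ¬ Split′ f → ∀ v → f (ones [ v ]≔ false) ≡ true
unsplit-ones {f = f} pos unsplit v with f (ones [ v ]≔ false) in fv
... | true  = refl
... | false =
  contradiction (v , inj₁ λ x → positive-false pos _ _ ([]≔-mono x ones (⪯-ones x) v false) fv) unsplit

minTrue-pair : {f : BoolFn n} → Positive f → ∀ {u j} → j ≢ u →
               f (unit u) ≡ false → f (unit j) ≡ false → f (unit j [ u ]≔ true) ≡ true →
               MinTrue f (unit j [ u ]≔ true)
minTrue-pair {f = f} pos {u} {j} j≢u fu fj fy = fy , λ z z⪯y fz → ⪯-antisym z⪯y
  ([]≔true-⪯ (unit j) z u
    ([]≔true-⪯ zeros z j (zeros-⪯ z) (positive-forces pos z (unit u) j fz (subst (z ⪯_) swap z⪯y) fu))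
    (positive-forces pos z (unit j) u fz z⪯y fj))
  where
  swap : unit j [ u ]≔ true ≡ unit u [ j ]≔ true
  swap = []≔-commutes zeros j u j≢u

-- Fixing a variable to 1

module FixedToTrue {f : BoolFn n} (pos : Positive f) (v : Fin n) where

  f₁ : BoolFn n
  f₁ = f ∣ v ≔ true

  _↑ : Vec Bool n → Vec Bool n
  x ↑ = x [ v ]≔ true

  Lower : Vec Bool n → Set
  Lower x = lookup x v ≡ false

  f₁-↑ : ∀ x → f₁ (x ↑) ≡ f (x ↑)
  f₁-↑ x = cong f ([]≔-idempotent x v)

  f≤f₁ : ∀ x → f x ≡ true → f₁ x ≡ true
  f≤f₁ x fx = pos _ _ fx (⪯-[]≔true x v)

  ↑≢ : ∀ {x} → Lower x → x ↑ ≢ x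
  ↑≢ {x} lower x↑≡x =
    true≢false (trans (sym (lookup∘update v x true)) (trans (cong (λ z → lookup z v) x↑≡x) lower))

  ¬maxFalse₁ : ∀ {x} → Lower x → ¬ MaxFalse f₁ x
  ¬maxFalse₁ {x} lower (f₁x , maximal) =
    ↑≢ lower (maximal (x ↑) (⪯-[]≔true x v) (trans (f₁-↑ x) f₁x))

  ¬minTrue₁-↑ : ∀ {x} → Lower x → ¬ MinTrue f₁ (x ↑)
  ¬minTrue₁-↑ {x} lower (f₁x↑ , minimal) =
    ↑≢ lower (sym (minimal x (⪯-[]≔true x v) (trans (sym (f₁-↑ x)) f₁x↑)))

  minTrue₁⇒ : ∀ {x} → Lower x → MinTrue f₁ x → MinTrue f x ⊎ MinTrue f (x ↑)
  minTrue₁⇒ {x} lower (f₁x , minimal) with f x in fx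
  ... | true  = inj₁ (refl , λ y y⪯x fy → minimal y y⪯x (f≤f₁ y fy))
  ... | false = inj₂ (f₁x , minimal↑)
    where
    minimal↑ : ∀ y → y ⪯ (x ↑) → f y ≡ true → y ≡ x ↑
    minimal↑ y y⪯x↑ fy with lookup y v in yᵥ
    ... | true  = trans (sym ([]≔-id y v yᵥ)) (trans (sym ([]≔-idempotent y v)) (cong _↑ y₀≡x))
      where
      y₀≡x : y [ v ]≔ false ≡ x
      y₀≡x = minimal _ (⪯-[]≔-cancel y x v true y⪯x↑) (trans (cong f ([]≔-idempotent y v)) (f≤f₁ y fy))
    ... | false = contradiction (trans (sym fy) (cong f y≡x)) (λ t≡f → true≢false (trans t≡f fx))
      where
      y≡x : y ≡ x
      y≡x = minimal y (⪯-[]≔true⁻ y x v y⪯x↑ yᵥ) (f≤f₁ y fy)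

  maxFalse₁⇒ : ∀ {x} → MaxFalse f₁ (x ↑) → MaxFalse f (x ↑)
  maxFalse₁⇒ {x} (f₁x↑ , maximal) = trans (sym (f₁-↑ x)) f₁x↑ , λ y x↑⪯y fy →
    maximal y x↑⪯y (trans (cong f ([]≔-id y v (x↑⪯y v (lookup∘update v x true)))) fy)

  maxFalse-↑ : ∀ {x} → Lower x → MaxFalse f x → f (x ↑) ≡ true
  maxFalse-↑ {x} lower (fx , maximal) with f (x ↑) in fx↑
  ... | true  = refl
  ... | false = contradiction (maximal (x ↑) (⪯-[]≔true x v) fx↑) (↑≢ lower)

  edge-≤ : ∀ x → edgeSum v (χ f₁) x ≤ edgeSum v (χ f) x
  edge-≤ x with lookup x v in lower
  ... | true  = z≤n
  ... | false =
    bits-≤ (extremal? f₁ x) (extremal? f₁ (x ↑)) (extremal? f x) (extremal? f (x ↑)) exclusive transfer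
    where
    exclusive : ¬ (Extremal f₁ x × Extremal f₁ (x ↑))
    exclusive (inj₁ max , _)     = ¬maxFalse₁ lower max
    exclusive (_ , inj₂ min)     = ¬minTrue₁-↑ lower min
    exclusive (inj₂ (f₁x , _) , inj₁ (f₁x↑ , _)) =
      true≢false (trans (sym f₁x) (trans (sym (f₁-↑ x)) f₁x↑))
    transfer : Extremal f₁ x ⊎ Extremal f₁ (x ↑) → Extremal f x ⊎ Extremal f (x ↑)
    transfer (inj₁ (inj₁ max)) = ⊥-elim (¬maxFalse₁ lower max)
    transfer (inj₁ (inj₂ min)) = Sum.map inj₂ inj₂ (minTrue₁⇒ lower min)
    transfer (inj₂ (inj₁ max)) = inj₂ (inj₁ (maxFalse₁⇒ max))
    transfer (inj₂ (inj₂ min)) = ⊥-elim (¬minTrue₁-↑ lower min)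

  Gain : Vec Bool n → Set
  Gain x = edgeSum v (χ f₁) x < edgeSum v (χ f) x

  gain-maxFalse : ∀ {x} → Lower x → MaxFalse f x → Gain x
  gain-maxFalse {x} lower max rewrite lower =
    bits-< (extremal? f₁ x) (extremal? f₁ (x ↑)) (extremal? f x) (extremal? f (x ↑)) ¬ext↑ (inj₁ max) transfer
    where
    ¬ext↑ : ¬ Extremal f₁ (x ↑)
    ¬ext↑ (inj₁ (f₁x↑ , _)) =
      true≢false (trans (sym (maxFalse-↑ lower max)) (trans (sym (f₁-↑ x)) f₁x↑))
    ¬ext↑ (inj₂ min)        = ¬minTrue₁-↑ lower min
    transfer : Extremal f₁ x → Extremal f (x ↑)
    transfer (inj₁ max₁) = ⊥-elim (¬maxFalse₁ lower max₁)
    transfer (inj₂ min₁) with minTrue₁⇒ lower min₁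
    ... | inj₁ (fx , _) = ⊥-elim (true≢false (trans (sym fx) (proj₁ max)))
    ... | inj₂ min      = inj₂ min

  gain-minTrue : ∀ {x} → Lower x → MinTrue f x → ¬ MinTrue f₁ x → Gain x
  gain-minTrue {x} lower min ¬min₁ rewrite lower =
    bits-< (extremal? f₁ x) (extremal? f₁ (x ↑)) (extremal? f x) (extremal? f (x ↑))
           ¬ext↑ (inj₂ min) (⊥-elim ∘ ¬ext)
    where
    ¬ext : ¬ Extremal f₁ x
    ¬ext (inj₁ max₁) = ¬maxFalse₁ lower max₁
    ¬ext (inj₂ min₁) = ¬min₁ min₁
    ¬ext↑ : ¬ Extremal f₁ (x ↑)
    ¬ext↑ (inj₁ (f₁x↑ , _)) =
      true≢false (trans (sym (f≤f₁ x (proj₁ min))) (trans (sym (f₁-↑ x)) f₁x↑))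
    ¬ext↑ (inj₂ min↑)       = ¬minTrue₁-↑ lower min↑

  numExtremal≡∑edge : ∀ g → numExtremal g ≡ ∑ (allVecs n) (edgeSum v (χ g))
  numExtremal≡∑edge g = trans (numExtremal≡∑χ g) (∑-edgeSum n v (χ g))

  numExtremal-< : ∀ {x} → Gain x → numExtremal f₁ < numExtremal f
  numExtremal-< {x} gain rewrite numExtremal≡∑edge f₁ | numExtremal≡∑edge f =
    ∑-< edge-≤ (∈-allVecs x) gain

  numExtremal-<₂ : ∀ {x y} → x ≢ y → Gain x → Gain y → 2 + numExtremal f₁ ≤ numExtremal f
  numExtremal-<₂ {x} {y} x≢y gx gy rewrite numExtremal≡∑edge f₁ | numExtremal≡∑edge f =
    ∑-<₂ edge-≤ x≢y (∈-allVecs x) (∈-allVecs y) gx gy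

  lowerMaxFalse-above : ∀ y → f y ≡ false → f (y ↑) ≡ true → ∃ λ F → Lower F × MaxFalse f F × y ⪯ F
  lowerMaxFalse-above y fy fy↑ with maxFalse-above pos y fy
  ... | F , max , y⪯F with lookup F v in Fᵥ
  ...   | false = F , Fᵥ , max , y⪯F
  ...   | true  = ⊥-elim (true≢false (trans (sym (pos _ _ fy↑ y↑⪯F)) (proj₁ max)))
    where
    y↑⪯F : (y ↑) ⪯ F
    y↑⪯F = subst ((y ↑) ⪯_) ([]≔-id F v Fᵥ) ([]≔-mono y F y⪯F v true)

  numExtremal-∣≔-< : Essential f v → numExtremal f₁ < numExtremal f
  numExtremal-∣≔-< ess with positive-flip pos ess
  ... | x , _ , fx , fx↑ with lowerMaxFalse-above x fx fx↑
  ...   | F , lower , max , _ = numExtremal-< (gain-maxFalse lower max)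

  -- Besides the lower maximal false point F₁ ⪰ unit u, look at y = unit j ∨ unit u with F₁ 0 at j: either
  -- f y = 0 and a lower maximal false point above y differs from F₁ at j, or y is a minimal true point of f
  -- that is not minimal for f₁, since f₁ (unit u) = 1.
  private
    two-gains : ∀ {u} → ¬ Split′ f → f₁ ∣ u ≔ true ≗ const true → ∀ {F₁} → Lower F₁ → MaxFalse f F₁ →
                ∀ {j} → j ≢ v → j ≢ u → u ≢ v → lookup F₁ j ≡ false → 2 + numExtremal f₁ ≤ numExtremal f
    two-gains {u} unsplit f₁ᵤ≗1 {F₁} lower₁ max₁ {j} j≢v j≢u u≢v F₁ⱼ with f (unit j [ u ]≔ true) in fy
    ... | false with lowerMaxFalse-above _ fy (f₁ᵤ≗1 (unit j))
    ...   | F₂ , lower₂ , max₂ , y⪯F₂ =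
      numExtremal-<₂ F₁≢F₂ (gain-maxFalse lower₁ max₁) (gain-maxFalse lower₂ max₂)
      where
      F₁≢F₂ : F₁ ≢ F₂
      F₁≢F₂ eq =
        true≢false (trans (sym (y⪯F₂ j (lookup-pair-j j≢u))) (trans (cong (λ z → lookup z j) (sym eq)) F₁ⱼ))
    two-gains {u} unsplit f₁ᵤ≗1 {F₁} lower₁ max₁ {j} j≢v j≢u u≢v F₁ⱼ | true =
      numExtremal-<₂ F₁≢y (gain-maxFalse lower₁ max₁)
        (gain-minTrue (lookup-pair-≢ (j≢v ∘ sym) (u≢v ∘ sym)) minTrue ¬minTrue₁)
      where
      y = unit j [ u ]≔ true
      F₁≢y : F₁ ≢ y
      F₁≢y eq = true≢false (trans (sym fy) (trans (cong f (sym eq)) (proj₁ max₁)))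
      minTrue : MinTrue f y
      minTrue = minTrue-pair pos j≢u (unsplit-unit pos unsplit u) (unsplit-unit pos unsplit j) fy
      ¬minTrue₁ : ¬ MinTrue f₁ y
      ¬minTrue₁ (_ , minimal) =
        true≢false (trans (sym (lookup-pair-j j≢u)) (trans (cong (λ z → lookup z j) (sym unit≡y)) unitⱼ))
        where
        unit≡y : unit u ≡ y
        unit≡y = minimal (unit u) ([]≔true-⪯ zeros y u (zeros-⪯ y) (lookup∘update u (unit j) true))
                         (f₁ᵤ≗1 zeros)
        unitⱼ : lookup (unit u) j ≡ false
        unitⱼ = trans (lookup∘update′ j≢u zeros true) (lookup-replicate j false)

  numExtremal-∣≔-<₂ : ¬ Split′ f → ∀ {u} → u ≢ v → f₁ ∣ u ≔ true ≗ const true →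
                      2 + numExtremal f₁ ≤ numExtremal f
  numExtremal-∣≔-<₂ unsplit {u} u≢v f₁ᵤ≗1
    with lowerMaxFalse-above (unit u) (unsplit-unit pos unsplit u) (f₁ᵤ≗1 zeros)
  ... | F₁ , lower₁ , max₁ , unit⪯F₁ with other-false F₁ v lower₁ F₁≢
    where
    F₁≢ : F₁ ≢ ones [ v ]≔ false
    F₁≢ eq = true≢false (trans (sym (unsplit-ones pos unsplit v)) (trans (cong f (sym eq)) (proj₁ max₁)))
  ...   | j , j≢v , F₁ⱼ = two-gains unsplit f₁ᵤ≗1 lower₁ max₁ j≢v j≢u u≢v F₁ⱼ
    where
    j≢u : j ≢ u
    j≢u refl = true≢false (trans (sym (unit⪯F₁ j (lookup∘update j zeros true))) F₁ⱼ)

-- The lower bound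

KeepsRelevant : BoolFn n → Fin n → Bool → Set
KeepsRelevant f v a = ∀ {w} → w ≢ v → Essential f w → Essential (f ∣ v ≔ a) w

Kills : BoolFn n → Fin n → Fin n → Set
Kills f v w = Essential f w × ¬ Essential (f ∣ v ≔ true) w

kills? : (f : BoolFn n) (v : Fin n) → Decidable (Kills f v)
kills? f v w = relevant? f w ×-dec ¬? (relevant? (f ∣ v ≔ true) w)

kills-self : {f : BoolFn n} {v : Fin n} → Essential f v → Kills f v v
kills-self {f = f} {v} ess = ess , inessential⇒¬essential (f ∣ v ≔ true) v (∣≔-inessential f v true)

kills-trans : {f : BoolFn n} {u v w : Fin n} → u ≢ v → w ≢ v → Kills f v u → Kills f u w → Kills f v w
kills-trans {f = f} {u} {v} {w} u≢v w≢v (_ , ¬essᵥᵤ) (essw , ¬essᵤw) =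
  essw , inessential⇒¬essential (f ∣ v ≔ true) w (λ x → trans (via x false) (sym (via x true)))
  where
  via : ∀ x a → f ((x [ w ]≔ a) [ v ]≔ true) ≡ f ((x [ v ]≔ true) [ u ]≔ true)
  via x a = begin
    f ((x [ w ]≔ a) [ v ]≔ true)
      ≡⟨ inessential-[]≔ (f ∣ v ≔ true) u (¬essential⇒inessential _ u ¬essᵥᵤ) (x [ w ]≔ a) true ⟨
    f (((x [ w ]≔ a) [ u ]≔ true) [ v ]≔ true)
      ≡⟨ cong f ([]≔-commutes (x [ w ]≔ a) u v u≢v) ⟩
    f (((x [ w ]≔ a) [ v ]≔ true) [ u ]≔ true)
      ≡⟨ cong (λ z → f (z [ u ]≔ true)) ([]≔-commutes x w v w≢v) ⟩
    f (((x [ v ]≔ true) [ w ]≔ a) [ u ]≔ true)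
      ≡⟨ inessential-[]≔ (f ∣ u ≔ true) w (¬essential⇒inessential _ w ¬essᵤw) (x [ v ]≔ true) a ⟩
    f ((x [ v ]≔ true) [ u ]≔ true) ∎
    where open ≡-Reasoning

-- Here f (y [ u ]≔ true) ≡ f (y [ v ]≔ true) for all y, so raising x_u lets a witness for x_w drop x_v to 0.
twins-keep : {f : BoolFn n} {u v : Fin n} → u ≢ v → Kills f v u → Kills f u v → KeepsRelevant f v false
twins-keep {f = f} {u} {v} u≢v (_ , ¬essᵥᵤ) (_ , ¬essᵤᵥ) {w} w≢v (flipsAt x differ) with lookup x v in xᵥ
... | false = flipsAt x λ same → differ (trans (sym (stays false)) (trans same (stays true)))
  where
  stays : ∀ b → f ((x [ w ]≔ b) [ v ]≔ false) ≡ f (x [ w ]≔ b)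
  stays b = cong f ([]≔-id _ v (trans (lookup∘update′ (w≢v ∘ sym) x b) xᵥ))
... | true with w ≟ u
...   | yes refl = contradiction (trans (pinned false) (sym (pinned true))) differ
  where
  pinned : ∀ b → f (x [ w ]≔ b) ≡ f (x [ v ]≔ true)
  pinned b = trans (cong f (sym ([]≔-id _ v (trans (lookup∘update′ (u≢v ∘ sym) x b) xᵥ))))
                   (inessential-[]≔ (f ∣ v ≔ true) w (¬essential⇒inessential _ w ¬essᵥᵤ) x b)
...   | no w≢u = flipsAt (x [ u ]≔ true) λ same → differ (trans (sym (via false)) (trans same (via true)))
  where
  symmetric : ∀ y → f (y [ u ]≔ true) ≡ f (y [ v ]≔ true)
  symmetric y = begin
    f (y [ u ]≔ true)
      ≡⟨ inessential-[]≔ (f ∣ u ≔ true) v (¬essential⇒inessential _ v ¬essᵤᵥ) y true ⟨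
    f ((y [ v ]≔ true) [ u ]≔ true)
      ≡⟨ cong f ([]≔-commutes y v u (u≢v ∘ sym)) ⟩
    f ((y [ u ]≔ true) [ v ]≔ true)
      ≡⟨ inessential-[]≔ (f ∣ v ≔ true) u (¬essential⇒inessential _ u ¬essᵥᵤ) y true ⟩
    f (y [ v ]≔ true) ∎
    where open ≡-Reasoning
  via : ∀ b → f (((x [ u ]≔ true) [ w ]≔ b) [ v ]≔ false) ≡ f (x [ w ]≔ b)
  via b = begin
    f (((x [ u ]≔ true) [ w ]≔ b) [ v ]≔ false)
      ≡⟨ cong (λ z → f (z [ v ]≔ false)) ([]≔-commutes x u w (w≢u ∘ sym)) ⟩
    f (((x [ w ]≔ b) [ u ]≔ true) [ v ]≔ false)
      ≡⟨ cong f ([]≔-commutes (x [ w ]≔ b) u v u≢v) ⟩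
    f (((x [ w ]≔ b) [ v ]≔ false) [ u ]≔ true)
      ≡⟨ symmetric _ ⟩
    f (((x [ w ]≔ b) [ v ]≔ false) [ v ]≔ true)
      ≡⟨ cong f ([]≔-idempotent _ v) ⟩
    f ((x [ w ]≔ b) [ v ]≔ true)
      ≡⟨ cong f ([]≔-id _ v (trans (lookup∘update′ (w≢v ∘ sym) x b) xᵥ)) ⟩
    f (x [ w ]≔ b) ∎
    where open ≡-Reasoning

GoodVariable : BoolFn n → Set
GoodVariable f = ∃ λ w → Essential f w × (KeepsRelevant f w true ⊎ KeepsRelevant f w false)

numKilled : BoolFn n → Fin n → ℕ
numKilled {n} f v = count (does ∘ kills? f v) (allFin n)

goodVariable-acc : (f : BoolFn n) {v : Fin n} → Essential f v → Acc _<_ (numKilled f v) → GoodVariable f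
goodVariable-acc f {v} ess (acc rec) with any? (λ u → ¬? (u ≟ v) ×-dec kills? f v u)
... | no none = v , ess , inj₁ keeps
  where
  keeps : KeepsRelevant f v true
  keeps {w} w≢v essw with relevant? (f ∣ v ≔ true) w
  ... | yes ess₁  = ess₁
  ... | no  ¬ess₁ = contradiction (w , w≢v , essw , ¬ess₁) none
... | yes (u , u≢v , kᵥᵤ) with relevant? (f ∣ u ≔ true) v
...   | no  ¬essᵤᵥ = v , ess , inj₂ (twins-keep u≢v kᵥᵤ (ess , ¬essᵤᵥ))
...   | yes essᵤᵥ  = goodVariable-acc f (proj₁ kᵥᵤ) (rec fewer)
  where
  killedByV : ∀ {w} → Kills f u w → Kills f v w
  killedByV {w} kᵤw with w ≟ v | w ≟ u
  ... | yes refl | _        = kills-self ess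
  ... | no _     | yes refl = kᵥᵤ
  ... | no w≢v   | no _     = kills-trans u≢v w≢v kᵥᵤ kᵤw
  fewer : numKilled f u < numKilled f v
  fewer = count-< (kills? f u) (kills? f v) killedByV (∈-allFin v) (kills-self ess)
                  (λ kᵤᵥ → proj₂ kᵤᵥ essᵤᵥ)

goodVariable : (f : BoolFn n) {v : Fin n} → Essential f v → GoodVariable f
goodVariable f ess = goodVariable-acc f ess (<-wellFounded _)

ExtremalBounds : BoolFn n → Set
ExtremalBounds f = suc (numRelevant f) ≤ numExtremal f
                 × (0 < numRelevant f → ¬ Split′ f → 2 + numRelevant f ≤ numExtremal f)

numExtremal-pos : {f : BoolFn n} → Positive f → 0 < numExtremal f
numExtremal-pos {f = f} pos with f zeros in f0
... | true  = count-pos (extremal? f) (∈-allVecs zeros) (inj₂ (f0 , λ y y⪯0 _ → ⪯-antisym y⪯0 (zeros-⪯ y)))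
... | false with maxFalse-above pos zeros f0
...   | F , max , _ = count-pos (extremal? f) (∈-allVecs F) (inj₁ max)

constant-split : {f : BoolFn n} {c : Bool} → Fin n → f ≗ const c → Split′ f
constant-split {c = false} v f≗c = v , inj₁ (λ x → f≗c (x [ v ]≔ false))
constant-split {c = true}  v f≗c = v , inj₂ (λ x → f≗c (x [ v ]≔ true))

extremalBounds-step : {f : BoolFn n} → Positive f → ∀ {v} → Essential f v → KeepsRelevant f v true →
                      ExtremalBounds (f ∣ v ≔ true) → ExtremalBounds f
extremalBounds-step {f = f} pos {v} ess keeps (lower₁ , unsplit⇒₁) = lower , unsplit⇒
  where
  open FixedToTrue pos v
  open ≤-Reasoning

  K≤ : numRelevant f ≤ suc (numRelevant f₁)
  K≤ = numRelevant-≤-suc keeps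

  lower : suc (numRelevant f) ≤ numExtremal f
  lower = begin
    suc (numRelevant f)        ≤⟨ s≤s K≤ ⟩
    2 + numRelevant f₁         ≤⟨ s≤s lower₁ ⟩
    suc (numExtremal f₁)       ≤⟨ numExtremal-∣≔-< ess ⟩
    numExtremal f              ∎

  unsplit⇒ : 0 < numRelevant f → ¬ Split′ f → 2 + numRelevant f ≤ numExtremal f
  unsplit⇒ _ unsplit with split? f₁
  ... | yes (u , inj₁ f₁ᵤ≗0) =
    contradiction (u , inj₁ λ x → positive-false pos _ _ (⪯-[]≔true (x [ u ]≔ false) v) (f₁ᵤ≗0 x))
                  unsplit
  ... | yes (u , inj₂ f₁ᵤ≗1) with u ≟ v
  ...   | yes refl =
    contradiction (v , inj₂ λ x → trans (cong f (sym ([]≔-idempotent x v))) (f₁ᵤ≗1 x)) unsplit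
  ...   | no  u≢v  = begin
    2 + numRelevant f          ≤⟨ s≤s (s≤s K≤) ⟩
    3 + numRelevant f₁         ≤⟨ s≤s (s≤s lower₁) ⟩
    2 + numExtremal f₁         ≤⟨ numExtremal-∣≔-<₂ unsplit u≢v f₁ᵤ≗1 ⟩
    numExtremal f              ∎
  unsplit⇒ _ unsplit | no unsplit₁ with essential-or-constant f₁
  ... | inj₂ f₁≗c        = contradiction (constant-split v f₁≗c) unsplit₁
  ... | inj₁ (_ , ess₁)  = begin
    2 + numRelevant f          ≤⟨ s≤s (s≤s K≤) ⟩
    3 + numRelevant f₁         ≤⟨ s≤s (unsplit⇒₁ (numRelevant-pos ess₁) unsplit₁) ⟩
    suc (numExtremal f₁)       ≤⟨ numExtremal-∣≔-< ess ⟩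
    numExtremal f              ∎

extremalBounds-dual⁻ : (f : BoolFn n) → ExtremalBounds (dual f) → ExtremalBounds f
extremalBounds-dual⁻ f bounds rewrite sym (numRelevant-dual f) | sym (numExtremal-dual f) =
  proj₁ bounds , λ K>0 unsplit → proj₂ bounds K>0 (unsplit ∘ split-dual⁻ f)

keepsRelevant-dual : {f : BoolFn n} {v : Fin n} → KeepsRelevant f v false → KeepsRelevant (dual f) v true
keepsRelevant-dual {f = f} {v} keeps w≢v ess =
  essential-≗ (λ x → sym (dual-∣≔ f v true x)) (essential-dual (keeps w≢v (essential-dual⁻ ess)))

extremalBounds-acc : (f : BoolFn n) → Positive f → Acc _<_ (numRelevant f) → ExtremalBounds f
extremalBounds-acc f pos (acc rec) with essential-or-constant f
... | inj₂ f≗c rewrite numRelevant-zero f (λ i x → trans (f≗c _) (sym (f≗c _))) =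
  numExtremal-pos pos , λ ()
... | inj₁ (_ , ess) with goodVariable f ess
...   | v , essᵥ , inj₁ keeps =
  extremalBounds-step pos essᵥ keeps
    (extremalBounds-acc (f ∣ v ≔ true) (∣≔-positive pos v true) (rec (numRelevant-∣≔-< true essᵥ)))
...   | v , essᵥ , inj₂ keeps =
  extremalBounds-dual⁻ f (extremalBounds-step (dual-positive pos) (essential-dual essᵥ) (keepsRelevant-dual keeps)
    (extremalBounds-acc (dual f ∣ v ≔ true) (∣≔-positive (dual-positive pos) v true) (rec fewer)))
  where
  fewer : numRelevant (dual f ∣ v ≔ true) < numRelevant f
  fewer = subst (numRelevant (dual f ∣ v ≔ true) <_) (numRelevant-dual f)
                (numRelevant-∣≔-< true (essential-dual essᵥ))

extremalBounds : (f : BoolFn n) → Positive f → ExtremalBounds f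
extremalBounds f pos = extremalBounds-acc f pos (<-wellFounded _)

-- Linear read-once functions

numRelevant-≗ : {f g : BoolFn n} → f ≗ g → numRelevant f ≡ numRelevant g
numRelevant-≗ {f = f} {g} f≗g =
  ≤-antisym (numRelevant-mono {f = f} {g} (essential-≗ f≗g))
            (numRelevant-mono {f = g} {f} (essential-≗ (sym ∘ f≗g)))

numExtremal-≗ : {f g : BoolFn n} → f ≗ g → numExtremal f ≡ numExtremal g
numExtremal-≗ {n} {f} {g} f≗g =
  ≤-antisym (count-mono (extremal? f) (extremal? g) (allVecs n) (extremal-≗ f≗g))
            (count-mono (extremal? g) (extremal? f) (allVecs n) (extremal-≗ (sym ∘ f≗g)))

numExtremal-constant : {f : BoolFn n} {c : Bool} → f ≗ const c → numExtremal f ≤ 1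
numExtremal-constant {n} {f} {false} f≗c = count-≤-1 (extremal? f) (≡-dec _≟ᴮ_) (allVecs-unique n) only
  where
  only : ∀ {y} → Extremal f y → y ≡ ones
  only {y} (inj₁ (_ , maximal)) = sym (maximal ones (⪯-ones y) (f≗c ones))
  only {y} (inj₂ (fy , _))      = ⊥-elim (true≢false (trans (sym fy) (f≗c y)))
numExtremal-constant {n} {f} {true} f≗c = count-≤-1 (extremal? f) (≡-dec _≟ᴮ_) (allVecs-unique n) only
  where
  only : ∀ {y} → Extremal f y → y ≡ zeros
  only {y} (inj₁ (fy , _))      = ⊥-elim (true≢false (trans (sym (f≗c y)) fy))
  only {y} (inj₂ (_ , minimal)) = sym (minimal zeros (zeros-⪯ y) (f≗c zeros))

⪯-false : (z x : Vec Bool n) (i : Fin n) → z ⪯ x → lookup x i ≡ false → lookup z i ≡ false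
⪯-false z x i z⪯x xᵢ with lookup z i in zᵢ
... | false = refl
... | true  = contradiction (trans (sym (z⪯x i zᵢ)) xᵢ) true≢false

module Conjunction {f : BoolFn n} (pos : Positive f) (u : Fin n) (f₀≗0 : f ∣ u ≔ false ≗ const false) where

  g : BoolFn n
  g = f ∣ u ≔ true

  decomposition : ∀ x → f x ≡ lookup x u ∧ g x
  decomposition x with lookup x u in xᵤ
  ... | true  = cong f (sym ([]≔-id x u xᵤ))
  ... | false = trans (cong f (sym ([]≔-id x u xᵤ))) (f₀≗0 x)

  keeps : KeepsRelevant f u true
  keeps {w} w≢u (flipsAt x differ) = flipsAt x λ same →
    differ (trans (at false) (trans (cong (lookup x u ∧_) same) (sym (at true))))
    where
    at : ∀ b → f (x [ w ]≔ b) ≡ lookup x u ∧ g (x [ w ]≔ b)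
    at b = trans (decomposition _) (cong (_∧ g (x [ w ]≔ b)) (lookup∘update′ (w≢u ∘ sym) x b))

  top : Vec Bool n
  top = ones [ u ]≔ false

  extremal-lower : ∀ x → lookup x u ≡ false → Extremal f x → x ≡ top
  extremal-lower x xᵤ (inj₂ (fx , _)) =
    ⊥-elim (true≢false (trans (sym fx) (trans (decomposition x) (cong (_∧ g x) xᵤ))))
  extremal-lower x xᵤ (inj₁ (_ , maximal)) = lookup-injective same
    where
    same : ∀ k → lookup x k ≡ lookup top k
    same k with k ≟ u
    ... | yes refl = trans xᵤ (sym (lookup∘update u ones false))
    ... | no  k≢u  = trans (trans (sym (cong (λ z → lookup z k) raised)) (lookup∘update k x true))
                           (sym (trans (lookup∘update′ k≢u ones false) (lookup-replicate k true)))
      where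
      raised : x [ k ]≔ true ≡ x
      raised = maximal _ (⪯-[]≔true x k)
        (trans (decomposition _) (cong (_∧ g (x [ k ]≔ true)) (trans (lookup∘update′ (k≢u ∘ sym) x true) xᵤ)))

  extremal-upper : ∀ x → lookup x u ≡ false → Extremal f (x [ u ]≔ true) →
                   Extremal g x ⊎ Extremal g (x [ u ]≔ true)
  extremal-upper x xᵤ (inj₂ (fx↑ , minimal)) = inj₁ (inj₂ (fx↑ , minimalᵍ))
    where
    minimalᵍ : ∀ z → z ⪯ x → g z ≡ true → z ≡ x
    minimalᵍ z z⪯x gz = begin
      z                                  ≡⟨ []≔-id z u (⪯-false z x u z⪯x xᵤ) ⟨
      z [ u ]≔ false                     ≡⟨ []≔-idempotent z u ⟨
      (z [ u ]≔ true) [ u ]≔ false       ≡⟨ cong (_[ u ]≔ false) (minimal _ ([]≔-mono z x z⪯x u true) gz) ⟩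
      (x [ u ]≔ true) [ u ]≔ false       ≡⟨ []≔-idempotent x u ⟩
      x [ u ]≔ false                     ≡⟨ []≔-id x u xᵤ ⟩
      x                                  ∎
      where open ≡-Reasoning
  extremal-upper x xᵤ (inj₁ (fx↑ , maximal)) =
    inj₂ (inj₁ (trans (cong f ([]≔-idempotent x u)) fx↑ , λ y x↑⪯y gy →
    maximal y x↑⪯y (trans (cong f (sym ([]≔-id y u (x↑⪯y u (lookup∘update u x true))))) gy)))

  numExtremal-≤ : numExtremal f ≤ suc (numExtremal g)
  numExtremal-≤ rewrite numExtremal≡∑χ f | numExtremal≡∑χ g | ∑-edgeSum n u (χ f) | ∑-edgeSum n u (χ g) =
    ∑-≤-suc (≡-dec _≟ᴮ_) (allVecs-unique n) edge-≤ edge-top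
    where
    upper : ∀ x → lookup x u ≡ false → χ f (x [ u ]≔ true) ≤ χ g x + χ g (x [ u ]≔ true)
    upper x xᵤ = bit-≤ (extremal? f _) (extremal? g x) (extremal? g _) (extremal-upper x xᵤ)
    edge-≤ : ∀ x → x ≢ top → edgeSum u (χ f) x ≤ edgeSum u (χ g) x
    edge-≤ x x≢top with lookup x u in xᵤ
    ... | true  = z≤n
    ... | false = subst (_≤ χ g x + χ g (x [ u ]≔ true))
                        (cong (_+ χ f (x [ u ]≔ true)) (sym (χ≡0 (x≢top ∘ extremal-lower x xᵤ))))
                        (upper x xᵤ)
    edge-top : edgeSum u (χ f) top ≤ suc (edgeSum u (χ g) top)
    edge-top rewrite lookup∘update u (ones {n}) false = +-mono-≤ (bit≤1 _) (upper top (lookup∘update u ones false))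

numExtremal-≤-conj : {f : BoolFn n} → Positive f → ∀ {u} → f ∣ u ≔ false ≗ const false → Essential f u →
                     numExtremal (f ∣ u ≔ true) ≤ suc (numRelevant (f ∣ u ≔ true)) →
                     numExtremal f ≤ suc (numRelevant f)
numExtremal-≤-conj {f = f} pos {u} f₀≗0 ess bound₁ = begin
  numExtremal f                    ≤⟨ Conjunction.numExtremal-≤ pos u f₀≗0 ⟩
  suc (numExtremal (f ∣ u ≔ true)) ≤⟨ s≤s bound₁ ⟩
  2 + numRelevant (f ∣ u ≔ true)   ≤⟨ s≤s (numRelevant-∣≔-< true ess) ⟩
  suc (numRelevant f)              ∎
  where open ≤-Reasoning

numExtremal-≤-disj : {f : BoolFn n} → Positive f → ∀ {u} → f ∣ u ≔ true ≗ const true → Essential f u →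
                     numExtremal (f ∣ u ≔ false) ≤ suc (numRelevant (f ∣ u ≔ false)) →
                     numExtremal f ≤ suc (numRelevant f)
numExtremal-≤-disj {f = f} pos {u} f₁≗1 ess bound₀ =
  subst₂ (λ e k → e ≤ suc k) (numExtremal-dual f) (numRelevant-dual f)
    (numExtremal-≤-conj (dual-positive pos) (λ x → trans (dual-∣≔ f u false x) (cong not (f₁≗1 _)))
                        (essential-dual ess)
      (subst₂ (λ e k → e ≤ suc k) (sym numExtremal-dual≔) (sym numRelevant-dual≔) bound₀))
  where
  dual≔ : dual f ∣ u ≔ true ≗ dual (f ∣ u ≔ false)
  dual≔ = dual-∣≔ f u true
  numExtremal-dual≔ : numExtremal (dual f ∣ u ≔ true) ≡ numExtremal (f ∣ u ≔ false)
  numExtremal-dual≔ = trans (numExtremal-≗ dual≔) (numExtremal-dual (f ∣ u ≔ false))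
  numRelevant-dual≔ : numRelevant (dual f ∣ u ≔ true) ≡ numRelevant (f ∣ u ≔ false)
  numRelevant-dual≔ = trans (numRelevant-≗ dual≔) (numRelevant-dual (f ∣ u ≔ false))

eval-[]≔ : (t : Formula n) {i : Fin n} → i ∉ vars t → ∀ x a → eval t (x [ i ]≔ a) ≡ eval t x
eval-[]≔ (lit j true)  i∉ x a = lookup∘update′ (λ j≡i → i∉ (here (sym j≡i))) x a
eval-[]≔ (lit j false) i∉ x a = cong not (lookup∘update′ (λ j≡i → i∉ (here (sym j≡i))) x a)
eval-[]≔ (φ ∨F ψ) i∉ x a =
  cong₂ _∨_ (eval-[]≔ φ (i∉ ∘ ∈-++⁺ˡ) x a) (eval-[]≔ ψ (i∉ ∘ ∈-++⁺ʳ (vars φ)) x a)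
eval-[]≔ (φ ∧F ψ) i∉ x a =
  cong₂ _∧_ (eval-[]≔ φ (i∉ ∘ ∈-++⁺ˡ) x a) (eval-[]≔ ψ (i∉ ∘ ∈-++⁺ʳ (vars φ)) x a)

literal-true : (i : Fin n) (b : Bool) (x : Vec Bool n) → eval (lit i b) (x [ i ]≔ b) ≡ true
literal-true i true  x = lookup∘update i x true
literal-true i false x = cong not (lookup∘update i x false)

literal-false : (i : Fin n) (b : Bool) (x : Vec Bool n) → eval (lit i b) (x [ i ]≔ not b) ≡ false
literal-false i true  x = lookup∘update i x false
literal-false i false x = cong not (lookup∘update i x true)

nested-nonconstant : {t : Formula n} → Nested t →
                     (∃ λ x → eval t x ≡ true) × (∃ λ x → eval t x ≡ false)
nested-nonconstant (nlit i b) =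
  (zeros [ i ]≔ b , literal-true i b zeros) , (zeros [ i ]≔ not b , literal-false i b zeros)
nested-nonconstant (nor i b {t} i∉ nt) with nested-nonconstant nt
... | _ , (x , tx) = (x [ i ]≔ b , cong (_∨ eval t (x [ i ]≔ b)) (literal-true i b x)) ,
                     (x [ i ]≔ not b , cong₂ _∨_ (literal-false i b x) (trans (eval-[]≔ t i∉ x (not b)) tx))
nested-nonconstant (nand i b {t} i∉ nt) with nested-nonconstant nt
... | (x , tx) , _ = (x [ i ]≔ b , cong₂ _∧_ (literal-true i b x) (trans (eval-[]≔ t i∉ x b) tx)) ,
                     (x [ i ]≔ not b , cong (_∧ eval t (x [ i ]≔ not b)) (literal-false i b x))

flips-essential : {f : BoolFn n} {i : Fin n} (x : Vec Bool n) →
                  f (x [ i ]≔ false) ≡ false → f (x [ i ]≔ true) ≡ true → Essential f i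
flips-essential x f₀ f₁ = flipsAt x λ same → true≢false (trans (sym f₁) (trans (sym same) f₀))

¬positive-negation : {f : BoolFn n} → Positive f → ∀ i x → ¬ (∀ b → f (x [ i ]≔ b) ≡ not b)
¬positive-negation pos i x f≗¬ =
  true≢false (trans (sym (pos _ _ (f≗¬ false) ([]≔false-⪯-[]≔true x i))) (f≗¬ true))

nested⇒bound : {φ : Formula n} → Nested φ → {f : BoolFn n} → Positive f → f ≗ eval φ →
               numExtremal f ≤ suc (numRelevant f)
nested⇒bound (nlit i true) {f} pos f≗φ =
  numExtremal-≤-conj pos (λ y → at y false) (flips-essential zeros (at zeros false) (at zeros true))
    (≤-trans (numExtremal-constant (λ y → at y true)) (s≤s z≤n))
  where
  at : ∀ y b → f (y [ i ]≔ b) ≡ b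
  at y b = trans (f≗φ _) (lookup∘update i y b)
nested⇒bound (nlit i false) pos f≗φ =
  ⊥-elim (¬positive-negation pos i zeros (λ b → trans (f≗φ _) (cong not (lookup∘update i zeros b))))
nested⇒bound (nand i true {t} i∉ nt) {f} pos f≗φ with nested-nonconstant nt
... | (x , tx) , _ =
  numExtremal-≤-conj pos (λ y → at y false) (flips-essential x (at x false) (trans (at x true) tx))
    (nested⇒bound nt (∣≔-positive pos i true) (λ y → at y true))
  where
  at : ∀ y b → f (y [ i ]≔ b) ≡ b ∧ eval t y
  at y b = trans (f≗φ _) (cong₂ _∧_ (lookup∘update i y b) (eval-[]≔ t i∉ y b))
nested⇒bound (nand i false {t} i∉ nt) {f} pos f≗φ with nested-nonconstant nt
... | (x , tx) , _ = ⊥-elim (¬positive-negation pos i x λ b →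
  trans (f≗φ _) (trans (cong₂ _∧_ (cong not (lookup∘update i x b)) (trans (eval-[]≔ t i∉ x b) tx))
                       (∧-identityʳ (not b))))
nested⇒bound (nor i true {t} i∉ nt) {f} pos f≗φ with nested-nonconstant nt
... | _ , (x , tx) =
  numExtremal-≤-disj pos (λ y → at y true) (flips-essential x (trans (at x false) tx) (at x true))
    (nested⇒bound nt (∣≔-positive pos i false) (λ y → at y false))
  where
  at : ∀ y b → f (y [ i ]≔ b) ≡ b ∨ eval t y
  at y b = trans (f≗φ _) (cong₂ _∨_ (lookup∘update i y b) (eval-[]≔ t i∉ y b))
nested⇒bound (nor i false {t} i∉ nt) {f} pos f≗φ with nested-nonconstant nt
... | _ , (x , tx) = ⊥-elim (¬positive-negation pos i x λ b →
  trans (f≗φ _) (trans (cong₂ _∨_ (cong not (lookup∘update i x b)) (trans (eval-[]≔ t i∉ x b) tx))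
                       (∨-identityʳ (not b))))

linearReadOnce⇒bound : {f : BoolFn n} → Positive f → LinearReadOnce f → numExtremal f ≤ suc (numRelevant f)
linearReadOnce⇒bound pos (inj₁ (_ , f≗c))          = ≤-trans (numExtremal-constant f≗c) (s≤s z≤n)
linearReadOnce⇒bound pos (inj₂ (_ , nested , f≗φ)) = nested⇒bound nested pos f≗φ

dualF : Formula n → Formula n
dualF (lit i b) = lit i b
dualF (φ ∨F ψ)  = dualF φ ∧F dualF ψ
dualF (φ ∧F ψ)  = dualF φ ∨F dualF ψ

eval-dualF : (φ : Formula n) (x : Vec Bool n) → eval (dualF φ) x ≡ not (eval φ (complement x))
eval-dualF (lit i true)  x = trans (sym (not-involutive _)) (cong not (sym (lookup-map i not x)))
eval-dualF (lit i false) x = cong not (eval-dualF (lit i true) x)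
eval-dualF (φ ∨F ψ) x rewrite eval-dualF φ x | eval-dualF ψ x = deMorgan (eval φ (complement x))
  where
  deMorgan : ∀ a {b} → not a ∧ not b ≡ not (a ∨ b)
  deMorgan true  = refl
  deMorgan false = refl
eval-dualF (φ ∧F ψ) x rewrite eval-dualF φ x | eval-dualF ψ x = deMorgan (eval φ (complement x))
  where
  deMorgan : ∀ a {b} → not a ∨ not b ≡ not (a ∧ b)
  deMorgan true  = refl
  deMorgan false = refl

vars-dualF : (φ : Formula n) → vars (dualF φ) ≡ vars φ
vars-dualF (lit i b) = refl
vars-dualF (φ ∨F ψ)  = cong₂ _++_ (vars-dualF φ) (vars-dualF ψ)
vars-dualF (φ ∧F ψ)  = cong₂ _++_ (vars-dualF φ) (vars-dualF ψ)

nested-dualF : {φ : Formula n} → Nested φ → Nested (dualF φ)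
nested-dualF (nlit i b)           = nlit i b
nested-dualF (nor i b {t} i∉ nt)  = nand i b (subst (i ∉_) (sym (vars-dualF t)) i∉) (nested-dualF nt)
nested-dualF (nand i b {t} i∉ nt) = nor i b (subst (i ∉_) (sym (vars-dualF t)) i∉) (nested-dualF nt)

-- Requiring every variable of φ to be relevant ensures u ∉ vars φ when x_u ∧ φ is formed.
LinearReadOnce′ : BoolFn n → Set
LinearReadOnce′ {n} f = (∃ λ c → f ≗ const c)
  ⊎ (∃ λ (φ : Formula n) → Nested φ × f ≗ eval φ × (∀ {j} → j ∈ vars φ → Essential f j))

linearReadOnce′-dual⁻ : (f : BoolFn n) → LinearReadOnce′ (dual f) → LinearReadOnce′ f
linearReadOnce′-dual⁻ f (inj₁ (c , df≗c)) =
  inj₁ (not c , λ x → trans (sym (dual-involutive f x)) (cong not (df≗c (complement x))))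
linearReadOnce′-dual⁻ f (inj₂ (φ , nested , df≗φ , relevantVars)) =
  inj₂ (dualF φ , nested-dualF nested , f≗φᵈ , essential-dual⁻ ∘ relevantVars ∘ subst (_ ∈_) (vars-dualF φ))
  where
  f≗φᵈ : f ≗ eval (dualF φ)
  f≗φᵈ x = trans (sym (dual-involutive f x)) (trans (cong not (df≗φ (complement x))) (sym (eval-dualF φ x)))

Tight : BoolFn n → Set
Tight f = numExtremal f ≡ suc (numRelevant f)

tight-conj : {f : BoolFn n} → Positive f → ∀ {u} → f ∣ u ≔ false ≗ const false → Tight f →
             (∀ g → Positive g → numRelevant g < numRelevant f → Tight g → LinearReadOnce′ g) →
             LinearReadOnce′ f
tight-conj {f = f} pos {u} f₀≗0 tight ih with relevant? f u
... | no ¬ess =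
  inj₁ (false , λ x → trans (sym (inessential-[]≔ f u (¬essential⇒inessential f u ¬ess) x false)) (f₀≗0 x))
... | yes ess = extend (ih g pos₁ (numRelevant-∣≔-< true ess) tight₁)
  where
  open Conjunction pos u f₀≗0
  pos₁ : Positive g
  pos₁ = ∣≔-positive pos u true
  tight₁ : Tight g
  tight₁ = ≤-antisym (≤-pred (begin
    suc (numExtremal g)      ≤⟨ FixedToTrue.numExtremal-∣≔-< pos u ess ⟩
    numExtremal f            ≡⟨ tight ⟩
    suc (numRelevant f)      ≤⟨ s≤s (numRelevant-≤-suc keeps) ⟩
    suc (suc (numRelevant g)) ∎)) (proj₁ (extremalBounds g pos₁))
    where open ≤-Reasoning
  extend : LinearReadOnce′ g → LinearReadOnce′ f
  extend (inj₁ (false , g≗0)) =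
    inj₁ (false , λ x → trans (decomposition x) (trans (cong (lookup x u ∧_) (g≗0 x)) (∧-zeroʳ _)))
  extend (inj₁ (true , g≗1)) =
    inj₂ (lit u true , nlit u true ,
          (λ x → trans (decomposition x) (trans (cong (lookup x u ∧_) (g≗1 x)) (∧-identityʳ _))) ,
          λ { (here refl) → ess })
  extend (inj₂ (φ , nested , g≗φ , relevantVars)) =
    inj₂ (lit u true ∧F φ , nand u true u∉ nested ,
          (λ x → trans (decomposition x) (cong (lookup x u ∧_) (g≗φ x))) ,
          λ { (here refl) → ess ; (there j∈) → essential-∣≔ (relevantVars j∈) })
    where
    u∉ : u ∉ vars φ
    u∉ = inessential⇒¬essential g u (∣≔-inessential f u true) ∘ relevantVars

tight⇒linearReadOnce′-acc : (f : BoolFn n) → Positive f → Acc _<_ (numRelevant f) → Tight f → LinearReadOnce′ f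
tight⇒linearReadOnce′-acc f pos (acc rec) tight with essential-or-constant f
... | inj₂ f≗c = inj₁ (_ , f≗c)
... | inj₁ (_ , ess) with split? f
...   | no unsplit =
  contradiction (subst (2 + numRelevant f ≤_) tight (proj₂ (extremalBounds f pos) (numRelevant-pos ess) unsplit))
                (n≮n _)
...   | yes (u , inj₁ f₀≗0) =
  tight-conj pos f₀≗0 tight λ g posg fewer → tight⇒linearReadOnce′-acc g posg (rec fewer)
...   | yes (u , inj₂ f₁≗1) = linearReadOnce′-dual⁻ f
  (tight-conj (dual-positive pos) (λ x → trans (dual-∣≔ f u false x) (cong not (f₁≗1 _)))
    (trans (numExtremal-dual f) (trans tight (cong suc (sym (numRelevant-dual f)))))
    λ g posg fewer → tight⇒linearReadOnce′-acc g posg (rec (subst (numRelevant g <_) (numRelevant-dual f) fewer)))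

tight⇒linearReadOnce : {f : BoolFn n} → Positive f → Tight f → LinearReadOnce f
tight⇒linearReadOnce {f = f} pos tight with tight⇒linearReadOnce′-acc f pos (<-wellFounded _) tight
... | inj₁ constant                  = inj₁ constant
... | inj₂ (φ , nested , f≗φ , _)    = inj₂ (φ , nested , f≗φ)

lemma2 : ∀ (n : ℕ) (f : BoolFn n) → Positive f → Threshold f → Split f →
    (suc (numRelevant f) ≤ numExtremal f)
    × ((numExtremal f ≡ suc (numRelevant f)) ⇔ LinearReadOnce f)
lemma2 n f pos _ _ = lower , mk⇔ (tight⇒linearReadOnce pos) tight
  where
  lower : suc (numRelevant f) ≤ numExtremal f
  lower = proj₁ (extremalBounds f pos)
  tight : LinearReadOnce f → numExtremal f ≡ suc (numRelevant f)
  tight lro = ≤-antisym (linearReadOnce⇒bound pos lro) lower
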